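{- Let $F(q,z)=\sum_{n\ge0}\sum_{\sigma\in\mathcal{S}_n(2\text{ - }3\text{ - }1)}q^{(13\text{ - }2)\sigma}z^{n}$. Then, as formal power series, $$F(q,z)=\cfrac{1}{1-\cfrac{z}{1-\cfrac{z}{1-\cfrac{zq}{1-\cfrac{zq}{1-\cfrac{zq^2}{1-\cfrac{zq^2}{\ddots}}}}}}},$$ the continued fraction whose $k$th partial numerator ($k=0,1,2,\dots$) is $zq^{\lfloor k/2\rfloor}$.
   Context: $\mathcal{S}_n(2\text{ - }3\text{ - }1)$ is the set of permutations $\sigma$ of $\{1,\dots,n\}$ with no $i<j<k$ such that $\sigma_k<\sigma_i<\sigma_j$. $(13\text{ - }2)\sigma$ is the number of pairs $(i,j)$ with $i+1<j$ and $\sigma_i<\sigma_j<\sigma_{i+1}$ (occurrences of the vincular pattern $13\text{ - }2$). -}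

module Defs where

open import Data.Nat using (ℕ; zero; suc; _+_; _*_; _∸_; _<_; _≤_)
open import Data.Nat.Properties using (_<?_; _≟_)
open import Data.Nat.DivMod using (_/_)
open import Data.Fin using (Fin; toℕ)
import Data.Fin as F
open import Data.Vec using (Vec; lookup)
open import Data.Product using (_×_)
open import Relation.Nullary using (Dec; yes; no)
open import Relation.Nullary.Decidable using (_×-dec_)
open import Relation.Binary.PropositionalEquality using (_≡_)

sumFin : ∀ n → (Fin n → ℕ) → ℕ
sumFin zero    f = 0
sumFin (suc n) f = f F.zero + sumFin n (λ i → f (F.suc i))

sumTo : ℕ → (ℕ → ℕ) → ℕ
sumTo zero    f = f 0
sumTo (suc n) f = sumTo n f + f (suc n)

ind : ∀ {p} {P : Set p} → Dec P → ℕ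
ind (yes _) = 1
ind (no  _) = 0

-- Words of length n over {0,…,n-1}; a permutation of {1..n} is
-- represented 0-indexed as the vector (σ_1 - 1, …, σ_n - 1).

Word : ℕ → Set
Word n = Vec (Fin n) n

val : ∀ {n} → Word n → Fin n → ℕ
val σ i = toℕ (lookup σ i)

-- number of pairs i < j with σ_i = σ_j  (σ is a permutation iff this is 0)
repeatedPairs : ∀ {n} → Word n → ℕ
repeatedPairs {n} σ =
  sumFin n λ i → sumFin n λ j →
    ind ((toℕ i <? toℕ j) ×-dec (val σ i ≟ val σ j))

occ2-3-1 : ∀ {n} → Word n → ℕ
occ2-3-1 {n} σ =
  sumFin n λ i → sumFin n λ j → sumFin n λ k →
    ind ((toℕ i <? toℕ j) ×-dec ((toℕ j <? toℕ k) ×-dec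
        ((val σ k <? val σ i) ×-dec (val σ i <? val σ j))))

-- number of occurrences of the vincular pattern 13-2:
-- pairs (i, j) with i+1 < j and σ_i < σ_j < σ_{i+1}.
-- (The position i+1 is written as an index k with k = i+1; since k is
-- determined by i this counts exactly the pairs (i, j).)
occ13-2 : ∀ {n} → Word n → ℕ
occ13-2 {n} σ =
  sumFin n λ i → sumFin n λ k → sumFin n λ j →
    ind ((toℕ k ≟ suc (toℕ i)) ×-dec ((toℕ k <? toℕ j) ×-dec
        ((val σ i <? val σ j) ×-dec (val σ j <? val σ k))))

Perm231With13-2 : ℕ → ℕ → Set
Perm231With13-2 n d =
  Data.Product.Σ (Word n) λ σ →
    (repeatedPairs σ ≡ 0) × (occ2-3-1 σ ≡ 0) × (occ13-2 σ ≡ d)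

-- Formal power series in z and q with ℕ coefficients:
-- S n d is the coefficient of z^n q^d.

Series : Set
Series = ℕ → ℕ → ℕ

one : Series
one zero    zero    = 1
one _       _       = 0

zq^ : ℕ → Series
zq^ a (suc zero) d with d ≟ a
... | yes _ = 1
... | no  _ = 0
zq^ a _ d = 0

_⊛_ : Series → Series → Series
(A ⊛ B) n d = sumTo n λ a → sumTo d λ b → A a b * B (n ∸ a) (d ∸ b)

pow : Series → ℕ → Series
pow X zero    = one
pow X (suc k) = X ⊛ pow X k

-- 1 / (1 - X) = Σ_k X^k, for X with no z^0 term (then X^k contributes
-- nothing to z^n when k > n, so the truncated sum is exact).
inv1- : Series → Series
inv1- X n d = sumTo n λ k → pow X k n d

-- convergents of the continued fraction whose k-th partial numerator is
-- z q^⌊k/2⌋: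
--   conv m k = 1 / (1 - z q^⌊k/2⌋ / (1 - z q^⌊(k+1)/2⌋ / ( … / 1)))
-- with m levels; the tail beyond depth m is replaced by 0.
conv : ℕ → ℕ → Series
conv zero    k = one
conv (suc m) k = inv1- (zq^ (k / 2) ⊛ conv m (suc k))

-- A 2-3-1-avoiding permutation of {0,…,n} factors at its maximum as α n β, and every
-- letter of α is smaller than every letter of β, since z < x with x in α and z in β
-- would make x n z a 2-3-1.  Either α is empty, and the occurrences of 13-2 are those
-- of β, or α is a nonempty 2-3-1-avoider of {0,…,|α|-1} and β one of the remaining
-- values, and the occurrences of 13-2 are those of α, those of β, and one for each
-- letter of β (sitting between the last letter of α and n).  Weighting permutations of
-- size n by q^(jn + #13-2), the generating function F_j thus satisfies F_j = 1 + F⁺_j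
-- and F⁺_j = zq^j F_j + zq^j F_{j+1} F⁺_j.  Two levels of the continued fraction,
-- H = 1/(1 - zq^j G) with G = 1/(1 - zq^j E), satisfy the same recursion for
-- H⁺ = zq^j G H as soon as E is the tail starting at zq^(j+1); since the z^n coefficient
-- of a convergent only involves its first 2n levels, induction on n identifies the
-- coefficients of the convergents with the weighted counts.

module Submission where

open import Defs
open import Level using (0ℓ)
open import Data.Bool using (Bool; true; false; if_then_else_; _∧_; T)
open import Data.Bool.Properties using (∧-zeroʳ; ∧-identityʳ)
open import Data.Empty using (⊥; ⊥-elim)
open import Data.Fin using (Fin; toℕ; fromℕ<) renaming (zero to fzero; suc to fsuc)
open import Data.Fin.Properties using (toℕ<n; toℕ-fromℕ<; fromℕ<-toℕ; +↔⊎; *↔×; 0↔⊥; 1↔⊤)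
open import Data.List using (List; []; _∷_; _++_; length; map; tabulate)
open import Data.List.Properties using (length-++; length-map; length-tabulate; map-∘; map-id-local)
import Data.List.Relation.Unary.All as All
open All using (All; []; _∷_)
open import Data.List.Relation.Unary.All.Properties using (++⁺; ++⁻ˡ; ++⁻ʳ; map⁺; tabulate⁺)
open import Data.Nat
open import Data.Nat.Properties
open import Algebra.Properties.CommutativeSemigroup +-commutativeSemigroup using (interchange)
open import Data.Nat.DivMod using (_/_; m*n/n≡m; +-distrib-/-∣ʳ)
open import Data.Nat.Divisibility using (divides-refl)
open import Data.Nat.Induction using (<-rec)
open import Data.Nat.Tactic.RingSolver using (solve-∀)
import Data.Product as Product
open Product using (Σ; Σ-syntax; ∃-syntax; _×_; _,_; proj₁; proj₂)
open import Data.Product.Function.Dependent.Propositional using (congˡ)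
open import Data.Product.Function.NonDependent.Propositional using (_×-cong_)
open import Data.Sum using (_⊎_; inj₁; inj₂)
open import Data.Sum.Function.Propositional using (_⊎-cong_)
open import Data.Unit using (tt)
open import Data.Vec using (Vec; []; _∷_; lookup)
open import Function using (_∘_; id)
open import Function.Bundles using (_↔_; mk↔ₛ′)
open import Function.Properties.Inverse using (↔-refl; ↔-trans)
import Function.Related.Propositional
open import Function.Related.TypeIsomorphisms using (Σ-distribˡ-⊎; ×-distribˡ-⊎; ∃-≡)
open import Relation.Binary.Bundles using (Setoid)
import Relation.Binary.Reasoning.Setoid
open import Relation.Binary.PropositionalEquality
open import Relation.Nullary using (¬_; Dec; does; yes; no; contradiction)
open import Relation.Nullary.Decidable using (_×-dec_)

-- Antidiagonal sums and products of series

antidiag : ℕ → (ℕ → ℕ → ℕ) → ℕ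
antidiag zero    g = g 0 0
antidiag (suc n) g = g 0 (suc n) + antidiag n (λ i j → g (suc i) j)

antidiag-cong : ∀ n {g h : ℕ → ℕ → ℕ} → (∀ i j → g i j ≡ h i j) → antidiag n g ≡ antidiag n h
antidiag-cong zero    e = e 0 0
antidiag-cong (suc n) e = cong₂ _+_ (e 0 (suc n)) (antidiag-cong n (λ i j → e (suc i) j))

antidiag-cong-on : ∀ n {g h : ℕ → ℕ → ℕ} → (∀ i j → i + j ≡ n → g i j ≡ h i j) →
                   antidiag n g ≡ antidiag n h
antidiag-cong-on zero    e = e 0 0 refl
antidiag-cong-on (suc n) e =
  cong₂ _+_ (e 0 (suc n) refl) (antidiag-cong-on n (λ i j i+j≡n → e (suc i) j (cong suc i+j≡n)))

antidiag-zero : ∀ n {g : ℕ → ℕ → ℕ} → (∀ i j → g i j ≡ 0) → antidiag n g ≡ 0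
antidiag-zero zero    e = e 0 0
antidiag-zero (suc n) e = cong₂ _+_ (e 0 (suc n)) (antidiag-zero n (λ i j → e (suc i) j))

antidiag-+ : ∀ n (g h : ℕ → ℕ → ℕ) → antidiag n (λ i j → g i j + h i j) ≡ antidiag n g + antidiag n h
antidiag-+ zero    g h = refl
antidiag-+ (suc n) g h =
  trans (cong (g 0 (suc n) + h 0 (suc n) +_) (antidiag-+ n _ _))
        (interchange (g 0 (suc n)) _ _ _)

antidiag-*ˡ : ∀ n c (g : ℕ → ℕ → ℕ) → c * antidiag n g ≡ antidiag n (λ i j → c * g i j)
antidiag-*ˡ zero    c g = refl
antidiag-*ˡ (suc n) c g =
  trans (*-distribˡ-+ c (g 0 (suc n)) _) (cong (c * g 0 (suc n) +_) (antidiag-*ˡ n c _))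

antidiag-*ʳ : ∀ n c (g : ℕ → ℕ → ℕ) → antidiag n g * c ≡ antidiag n (λ i j → g i j * c)
antidiag-*ʳ n c g =
  trans (*-comm (antidiag n g) c) (trans (antidiag-*ˡ n c g) (antidiag-cong n (λ i j → *-comm c (g i j))))

antidiag-snoc : ∀ n (g : ℕ → ℕ → ℕ) →
                antidiag (suc n) g ≡ antidiag n (λ i j → g i (suc j)) + g (suc n) 0
antidiag-snoc zero    g = refl
antidiag-snoc (suc n) g =
  trans (cong (g 0 (suc (suc n)) +_) (antidiag-snoc n (λ i j → g (suc i) j)))
        (sym (+-assoc (g 0 (suc (suc n))) _ _))

antidiag-flip : ∀ n (g : ℕ → ℕ → ℕ) → antidiag n g ≡ antidiag n (λ i j → g j i)
antidiag-flip zero    g = refl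
antidiag-flip (suc n) g =
  trans (cong (g 0 (suc n) +_) (antidiag-flip n (λ i j → g (suc i) j)))
        (trans (+-comm (g 0 (suc n)) _) (sym (antidiag-snoc n (λ i j → g j i))))

antidiag-comm : ∀ n m (g : ℕ → ℕ → ℕ → ℕ → ℕ) →
  antidiag n (λ i j → antidiag m (g i j)) ≡ antidiag m (λ k l → antidiag n (λ i j → g i j k l))
antidiag-comm zero    m g = refl
antidiag-comm (suc n) m g =
  trans (cong (antidiag m (g 0 (suc n)) +_) (antidiag-comm n m (λ i → g (suc i))))
        (sym (antidiag-+ m _ _))

antidiag-assoc : ∀ n (h : ℕ → ℕ → ℕ → ℕ) →
  antidiag n (λ a r → antidiag r (h a)) ≡ antidiag n (λ s c → antidiag s (λ a b → h a b c))
antidiag-assoc zero    h = refl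
antidiag-assoc (suc n) h =
  trans (cong (antidiag (suc n) (h 0) +_) (antidiag-assoc n (λ a → h (suc a))))
        (trans (+-assoc (h 0 0 (suc n)) _ _)
               (cong (h 0 0 (suc n) +_) (sym (antidiag-+ n _ _))))

antidiag-single : ∀ d j (g : ℕ → ℕ → ℕ) → j ≤ d → (∀ i i′ → i ≢ j → g i i′ ≡ 0) →
                  antidiag d g ≡ g j (d ∸ j)
antidiag-single zero    zero    g _ _ = refl
antidiag-single (suc d) zero    g _ g≡0 =
  trans (cong (g 0 (suc d) +_) (antidiag-zero d (λ i i′ → g≡0 (suc i) i′ (λ ())))) (+-identityʳ _)
antidiag-single (suc d) (suc j) g (s≤s j≤d) g≡0 =
  trans (cong (_+ antidiag d (λ i → g (suc i))) (g≡0 0 (suc d) (λ ())))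
        (antidiag-single d j (λ i → g (suc i)) j≤d (λ i i′ i≢j → g≡0 (suc i) i′ (i≢j ∘ suc-injective)))

antidiag-none : ∀ d j (g : ℕ → ℕ → ℕ) → d < j → (∀ i i′ → i ≢ j → g i i′ ≡ 0) →
                antidiag d g ≡ 0
antidiag-none d j g d<j g≡0 =
  trans (antidiag-cong-on d (λ i i′ i+i′≡d → g≡0 i i′ (λ i≡j → <⇒≱ d<j (i≤d i≡j i+i′≡d))))
        (antidiag-zero d (λ _ _ → refl))
  where
  i≤d : ∀ {i i′} → i ≡ j → i + i′ ≡ d → j ≤ d
  i≤d {i} {i′} refl i+i′≡d = subst (i ≤_) i+i′≡d (m≤m+n i i′)

sumTo-cong : ∀ n {f g : ℕ → ℕ} → (∀ i → f i ≡ g i) → sumTo n f ≡ sumTo n g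
sumTo-cong zero    e = e 0
sumTo-cong (suc n) e = cong₂ _+_ (sumTo-cong n e) (e (suc n))

sumTo-unfoldˡ : ∀ n (f : ℕ → ℕ) → sumTo (suc n) f ≡ f 0 + sumTo n (λ i → f (suc i))
sumTo-unfoldˡ zero    f = refl
sumTo-unfoldˡ (suc n) f = trans (cong (_+ f (suc (suc n))) (sumTo-unfoldˡ n f)) (+-assoc (f 0) _ _)

sumTo-*ˡ : ∀ n c (f : ℕ → ℕ) → c * sumTo n f ≡ sumTo n (λ i → c * f i)
sumTo-*ˡ zero    c f = refl
sumTo-*ˡ (suc n) c f = trans (*-distribˡ-+ c (sumTo n f) _) (cong (_+ c * f (suc n)) (sumTo-*ˡ n c f))

sumTo≡antidiag : ∀ n (g : ℕ → ℕ → ℕ) → sumTo n (λ i → g i (n ∸ i)) ≡ antidiag n g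
sumTo≡antidiag zero    g = refl
sumTo≡antidiag (suc n) g =
  trans (sumTo-unfoldˡ n (λ i → g i (suc n ∸ i))) (cong (g 0 (suc n) +_) (sumTo≡antidiag n (λ i → g (suc i))))

sumTo-antidiag-comm : ∀ N n (g : ℕ → ℕ → ℕ → ℕ) →
  sumTo N (λ k → antidiag n (g k)) ≡ antidiag n (λ i j → sumTo N (λ k → g k i j))
sumTo-antidiag-comm zero    n g = refl
sumTo-antidiag-comm (suc N) n g =
  trans (cong (_+ antidiag n (g (suc N))) (sumTo-antidiag-comm N n g)) (sym (antidiag-+ n _ _))

sumTo-vanishing-tail : ∀ a k (f : ℕ → ℕ) → (∀ i → a < i → f i ≡ 0) → sumTo (k + a) f ≡ sumTo a f
sumTo-vanishing-tail a zero    f f>a≡0 = refl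
sumTo-vanishing-tail a (suc k) f f>a≡0 =
  trans (cong (sumTo (k + a) f +_) (f>a≡0 (suc (k + a)) (s≤s (m≤n+m a k))))
        (trans (+-identityʳ _) (sumTo-vanishing-tail a k f f>a≡0))

infix  4 _≈_
infixl 6 _⊕_

_≈_ : Series → Series → Set
A ≈ B = ∀ n d → A n d ≡ B n d

≈-setoid : Setoid 0ℓ 0ℓ
≈-setoid = record
  { Carrier       = Series
  ; _≈_           = _≈_
  ; isEquivalence = record
    { refl  = λ n d → refl
    ; sym   = λ e n d → sym (e n d)
    ; trans = λ e f n d → trans (e n d) (f n d)
    }
  }

module ≈-Reasoning = Relation.Binary.Reasoning.Setoid ≈-setoid

_⊕_ : Series → Series → Series
(A ⊕ B) n d = A n d + B n d

⊕-cong : ∀ {A A′ B B′} → A ≈ A′ → B ≈ B′ → A ⊕ B ≈ A′ ⊕ B′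
⊕-cong e f n d = cong₂ _+_ (e n d) (f n d)

⊕-congʳ : ∀ A {B B′} → B ≈ B′ → A ⊕ B ≈ A ⊕ B′
⊕-congʳ A f = ⊕-cong {A = A} (λ _ _ → refl) f

⊛-antidiag : ∀ A B n d → (A ⊛ B) n d ≡ antidiag n (λ a a′ → antidiag d (λ b b′ → A a b * B a′ b′))
⊛-antidiag A B n d =
  trans (sumTo-cong n (λ a → sumTo≡antidiag d (λ b b′ → A a b * B (n ∸ a) b′)))
        (sumTo≡antidiag n (λ a a′ → antidiag d (λ b b′ → A a b * B a′ b′)))

⊛-cong : ∀ {A A′ B B′} → A ≈ A′ → B ≈ B′ → A ⊛ B ≈ A′ ⊛ B′
⊛-cong {A} {A′} {B} {B′} e f n d = begin
  (A ⊛ B) n d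
    ≡⟨ ⊛-antidiag A B n d ⟩
  antidiag n (λ a a′ → antidiag d (λ b b′ → A a b * B a′ b′))
    ≡⟨ antidiag-cong n (λ a a′ → antidiag-cong d (λ b b′ → cong₂ _*_ (e a b) (f a′ b′))) ⟩
  antidiag n (λ a a′ → antidiag d (λ b b′ → A′ a b * B′ a′ b′))
    ≡⟨ ⊛-antidiag A′ B′ n d ⟨
  (A′ ⊛ B′) n d ∎
  where open ≡-Reasoning

⊛-congˡ : ∀ {A A′} B → A ≈ A′ → A ⊛ B ≈ A′ ⊛ B
⊛-congˡ B e = ⊛-cong {B = B} e (λ _ _ → refl)

⊛-congʳ : ∀ A {B B′} → B ≈ B′ → A ⊛ B ≈ A ⊛ B′
⊛-congʳ A f = ⊛-cong {A = A} (λ _ _ → refl) f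

⊛-comm : ∀ A B → A ⊛ B ≈ B ⊛ A
⊛-comm A B n d = begin
  (A ⊛ B) n d
    ≡⟨ ⊛-antidiag A B n d ⟩
  antidiag n (λ a a′ → antidiag d (λ b b′ → A a b * B a′ b′))
    ≡⟨ antidiag-flip n _ ⟩
  antidiag n (λ a a′ → antidiag d (λ b b′ → A a′ b * B a b′))
    ≡⟨ antidiag-cong n (λ a a′ → trans (antidiag-flip d _)
                                       (antidiag-cong d (λ b b′ → *-comm (A a′ b′) (B a b)))) ⟩
  antidiag n (λ a a′ → antidiag d (λ b b′ → B a b * A a′ b′))
    ≡⟨ ⊛-antidiag B A n d ⟨
  (B ⊛ A) n d ∎
  where open ≡-Reasoning

⊛-distribˡ-⊕ : ∀ A B C → A ⊛ (B ⊕ C) ≈ A ⊛ B ⊕ A ⊛ C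
⊛-distribˡ-⊕ A B C n d = begin
  (A ⊛ (B ⊕ C)) n d
    ≡⟨ ⊛-antidiag A (B ⊕ C) n d ⟩
  antidiag n (λ a a′ → antidiag d (λ b b′ → A a b * (B a′ b′ + C a′ b′)))
    ≡⟨ antidiag-cong n (λ a a′ → trans (antidiag-cong d (λ b b′ → *-distribˡ-+ (A a b) _ _))
                                       (antidiag-+ d _ _)) ⟩
  antidiag n (λ a a′ → antidiag d (λ b b′ → A a b * B a′ b′) + antidiag d (λ b b′ → A a b * C a′ b′))
    ≡⟨ antidiag-+ n _ _ ⟩
  antidiag n (λ a a′ → antidiag d (λ b b′ → A a b * B a′ b′)) +
  antidiag n (λ a a′ → antidiag d (λ b b′ → A a b * C a′ b′))
    ≡⟨ cong₂ _+_ (⊛-antidiag A B n d) (⊛-antidiag A C n d) ⟨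
  (A ⊛ B ⊕ A ⊛ C) n d ∎
  where open ≡-Reasoning

⊛-distribʳ-⊕ : ∀ A B C → (A ⊕ B) ⊛ C ≈ A ⊛ C ⊕ B ⊛ C
⊛-distribʳ-⊕ A B C = begin
  (A ⊕ B) ⊛ C     ≈⟨ ⊛-comm (A ⊕ B) C ⟩
  C ⊛ (A ⊕ B)     ≈⟨ ⊛-distribˡ-⊕ C A B ⟩
  C ⊛ A ⊕ C ⊛ B   ≈⟨ ⊕-cong (⊛-comm C A) (⊛-comm C B) ⟩
  A ⊛ C ⊕ B ⊛ C   ∎
  where open ≈-Reasoning

⊛-identityˡ : ∀ B → one ⊛ B ≈ B
⊛-identityˡ B n d = trans (⊛-antidiag one B n d) (outer n)
  where
  inner : ∀ d (Y : ℕ → ℕ) → antidiag d (λ b b′ → one 0 b * Y b′) ≡ Y d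
  inner zero    Y = *-identityˡ (Y 0)
  inner (suc d) Y =
    trans (cong₂ _+_ (*-identityˡ (Y (suc d))) (antidiag-zero d (λ _ _ → refl))) (+-identityʳ _)
  outer : ∀ n → antidiag n (λ a a′ → antidiag d (λ b b′ → one a b * B a′ b′)) ≡ B n d
  outer zero    = inner d (B 0)
  outer (suc n) = trans (cong₂ _+_ (inner d (B (suc n)))
                                   (antidiag-zero n (λ _ _ → antidiag-zero d (λ _ _ → refl))))
                        (+-identityʳ _)

⊛-assoc : ∀ A B C → (A ⊛ B) ⊛ C ≈ A ⊛ (B ⊛ C)
⊛-assoc A B C n d = begin
  ((A ⊛ B) ⊛ C) n d
    ≡⟨ ⊛-antidiag (A ⊛ B) C n d ⟩
  antidiag n (λ s c → antidiag d (λ e f → (A ⊛ B) s e * C c f))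
    ≡⟨ antidiag-cong n (λ s c → antidiag-cong d (λ e f → expandˡ s e (C c f))) ⟩
  antidiag n (λ s c → antidiag d (λ e f → antidiag s (λ a b → antidiag e (λ x y → A a x * B b y * C c f))))
    ≡⟨ antidiag-cong n (λ s c → antidiag-comm d s _) ⟩
  antidiag n (λ s c → antidiag s (λ a b → antidiag d (λ e f → antidiag e (λ x y → A a x * B b y * C c f))))
    ≡⟨ antidiag-cong n (λ s c → antidiag-cong s (λ a b → antidiag-assoc d _)) ⟨
  antidiag n (λ s c → antidiag s (λ a b → antidiag d (λ x r → antidiag r (λ y f → A a x * B b y * C c f))))
    ≡⟨ antidiag-assoc n _ ⟨
  antidiag n (λ a r → antidiag r (λ b c → antidiag d (λ x r′ → antidiag r′ (λ y f → A a x * B b y * C c f))))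
    ≡⟨ antidiag-cong n (λ a r → antidiag-cong r (λ b c → antidiag-cong d (λ x r′ →
         antidiag-cong r′ (λ y f → *-assoc (A a x) (B b y) (C c f))))) ⟩
  antidiag n (λ a r → antidiag r (λ b c → antidiag d (λ x r′ → antidiag r′ (λ y f → A a x * (B b y * C c f)))))
    ≡⟨ antidiag-cong n (λ a r → antidiag-comm r d _) ⟩
  antidiag n (λ a r → antidiag d (λ x r′ → antidiag r (λ b c → antidiag r′ (λ y f → A a x * (B b y * C c f)))))
    ≡⟨ antidiag-cong n (λ a r → antidiag-cong d (λ x r′ → expandʳ (A a x) r r′)) ⟨
  antidiag n (λ a r → antidiag d (λ x r′ → A a x * (B ⊛ C) r r′))
    ≡⟨ ⊛-antidiag A (B ⊛ C) n d ⟨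
  (A ⊛ (B ⊛ C)) n d ∎
  where
  open ≡-Reasoning
  expandˡ : ∀ s e z → (A ⊛ B) s e * z ≡ antidiag s (λ a b → antidiag e (λ x y → A a x * B b y * z))
  expandˡ s e z = trans (cong (_* z) (⊛-antidiag A B s e))
                        (trans (antidiag-*ʳ s z _) (antidiag-cong s (λ a b → antidiag-*ʳ e z _)))
  expandʳ : ∀ w r r′ → w * (B ⊛ C) r r′ ≡ antidiag r (λ b c → antidiag r′ (λ y f → w * (B b y * C c f)))
  expandʳ w r r′ = trans (cong (w *_) (⊛-antidiag B C r r′))
                         (trans (antidiag-*ˡ r w _) (antidiag-cong r (λ b c → antidiag-*ˡ r′ w _)))

-- The continued fraction, two levels at a time

NoConstantTerm : Series → Set
NoConstantTerm X = ∀ d → X 0 d ≡ 0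

⊛-noConstantTerm : ∀ X Y → NoConstantTerm X → NoConstantTerm (X ⊛ Y)
⊛-noConstantTerm X Y X₀≡0 d =
  trans (⊛-antidiag X Y 0 d) (antidiag-zero d (λ b b′ → cong (_* Y 0 b′) (X₀≡0 b)))

pow-vanishes : ∀ X → NoConstantTerm X → ∀ k a b → a < k → pow X k a b ≡ 0
pow-vanishes X X₀≡0 (suc k) a b a<1+k =
  trans (⊛-antidiag X (pow X k) a b)
        (trans (antidiag-cong-on a (λ i i′ i+i′≡a → antidiag-zero b (term i i′ i+i′≡a)))
               (antidiag-zero a (λ _ _ → refl)))
  where
  term : ∀ i i′ → i + i′ ≡ a → ∀ e e′ → X i e * pow X k i′ e′ ≡ 0
  term zero    i′ _ e e′ = cong (_* pow X k i′ e′) (X₀≡0 e)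
  term (suc i) i′ i+i′≡a e e′ =
    trans (cong (X (suc i) e *_) (pow-vanishes X X₀≡0 k i′ e′ i′<k)) (*-zeroʳ (X (suc i) e))
    where
    i′<k : i′ < k
    i′<k = ≤-<-trans (m≤n+m i′ i) (≤-trans (≤-reflexive i+i′≡a) (≤-pred a<1+k))

geometric-unfold : ∀ X → NoConstantTerm X → inv1- X ≈ one ⊕ X ⊛ inv1- X
geometric-unfold X X₀≡0 zero d =
  sym (trans (cong (one 0 d +_) (⊛-noConstantTerm X (inv1- X) X₀≡0 d)) (+-identityʳ _))
geometric-unfold X X₀≡0 (suc n) d = begin
  inv1- X (suc n) d
    ≡⟨ sumTo-unfoldˡ n (λ k → pow X k (suc n) d) ⟩
  sumTo n (λ k → (X ⊛ pow X k) (suc n) d)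
    ≡⟨ sumTo-cong n (λ k → ⊛-antidiag X (pow X k) (suc n) d) ⟩
  sumTo n (λ k → antidiag (suc n) (λ a a′ → antidiag d (λ b b′ → X a b * pow X k a′ b′)))
    ≡⟨ sumTo-antidiag-comm n (suc n) (λ k a a′ → antidiag d (λ b b′ → X a b * pow X k a′ b′)) ⟩
  antidiag (suc n) (λ a a′ → sumTo n (λ k → antidiag d (λ b b′ → X a b * pow X k a′ b′)))
    ≡⟨ antidiag-cong (suc n) (λ a a′ → sumTo-antidiag-comm n d (λ k b b′ → X a b * pow X k a′ b′)) ⟩
  antidiag (suc n) (λ a a′ → antidiag d (λ b b′ → sumTo n (λ k → X a b * pow X k a′ b′)))
    ≡⟨ antidiag-cong-on (suc n) (λ a a′ a+a′≡1+n → antidiag-cong d (truncation-exact a a′ a+a′≡1+n)) ⟩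
  antidiag (suc n) (λ a a′ → antidiag d (λ b b′ → X a b * inv1- X a′ b′))
    ≡⟨ ⊛-antidiag X (inv1- X) (suc n) d ⟨
  (one ⊕ X ⊛ inv1- X) (suc n) d ∎
  where
  open ≡-Reasoning
  truncation-exact : ∀ a a′ → a + a′ ≡ suc n → ∀ b b′ →
             sumTo n (λ k → X a b * pow X k a′ b′) ≡ X a b * inv1- X a′ b′
  truncation-exact zero    a′ _ b b′ =
    trans (sym (sumTo-*ˡ n (X 0 b) _))
          (trans (cong (_* sumTo n (λ k → pow X k a′ b′)) (X₀≡0 b))
                 (sym (cong (_* inv1- X a′ b′) (X₀≡0 b))))
  truncation-exact (suc a) a′ a+a′≡1+n b b′ = trans (sym (sumTo-*ˡ n (X (suc a) b) _)) (cong (X (suc a) b *_) (begin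
    sumTo n (λ k → pow X k a′ b′)
      ≡⟨ cong (λ m → sumTo m (λ k → pow X k a′ b′)) (m∸n+n≡m a′≤n) ⟨
    sumTo (n ∸ a′ + a′) (λ k → pow X k a′ b′)
      ≡⟨ sumTo-vanishing-tail a′ (n ∸ a′) _ (λ k → pow-vanishes X X₀≡0 k a′ b′) ⟩
    inv1- X a′ b′ ∎))
    where
    a′≤n : a′ ≤ n
    a′≤n = subst (a′ ≤_) (suc-injective a+a′≡1+n) (m≤n+m a′ a)

zq^-at : ∀ j → zq^ j 1 j ≡ 1
zq^-at j with j ≟ j
... | yes _   = refl
... | no j≢j = contradiction refl j≢j

zq^-off-exponent : ∀ j a {b} → b ≢ j → zq^ j a b ≡ 0
zq^-off-exponent j zero          _   = refl
zq^-off-exponent j (suc zero)    {b} b≢j with b ≟ j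
... | yes b≡j = contradiction b≡j b≢j
... | no _    = refl
zq^-off-exponent j (suc (suc a)) _   = refl

zq^-off-degree : ∀ j {a} b → a ≢ 1 → zq^ j a b ≡ 0
zq^-off-degree j {zero}        b _   = refl
zq^-off-degree j {suc zero}    b a≢1 = contradiction refl a≢1
zq^-off-degree j {suc (suc a)} b _   = refl

zq^-⊛-≤ : ∀ j Y n d → j ≤ d → (zq^ j ⊛ Y) (suc n) d ≡ Y n (d ∸ j)
zq^-⊛-≤ j Y n d j≤d = begin
  (zq^ j ⊛ Y) (suc n) d
    ≡⟨ ⊛-antidiag (zq^ j) Y (suc n) d ⟩
  antidiag (suc n) (λ a a′ → antidiag d (λ b b′ → zq^ j a b * Y a′ b′))
    ≡⟨ antidiag-single (suc n) 1 _ (s≤s z≤n)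
         (λ a a′ a≢1 → antidiag-zero d (λ b b′ → cong (_* Y a′ b′) (zq^-off-degree j b a≢1))) ⟩
  antidiag d (λ b b′ → zq^ j 1 b * Y n b′)
    ≡⟨ antidiag-single d j _ j≤d (λ b b′ b≢j → cong (_* Y n b′) (zq^-off-exponent j 1 b≢j)) ⟩
  zq^ j 1 j * Y n (d ∸ j)
    ≡⟨ cong (_* Y n (d ∸ j)) (zq^-at j) ⟩
  1 * Y n (d ∸ j)
    ≡⟨ *-identityˡ _ ⟩
  Y n (d ∸ j) ∎
  where open ≡-Reasoning

zq^-⊛-> : ∀ j Y n d → d < j → (zq^ j ⊛ Y) (suc n) d ≡ 0
zq^-⊛-> j Y n d d<j =
  trans (⊛-antidiag (zq^ j) Y (suc n) d)
        (antidiag-zero (suc n) (λ a a′ → antidiag-none d j _ d<j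
          (λ b b′ b≢j → cong (_* Y a′ b′) (zq^-off-exponent j a b≢j))))

pow-cong : ∀ {X Y} → X ≈ Y → ∀ k → pow X k ≈ pow Y k
pow-cong e zero    = λ _ _ → refl
pow-cong e (suc k) = ⊛-cong e (pow-cong e k)

inv1-cong : ∀ {X Y} → X ≈ Y → inv1- X ≈ inv1- Y
inv1-cong e n d = sumTo-cong n (λ k → pow-cong e k n d)

module TwoLevels (j : ℕ) (E : Series) where

  X G H H⁺ : Series
  X  = zq^ j
  G  = inv1- (X ⊛ E)
  H  = inv1- (X ⊛ G)
  H⁺ = (X ⊛ G) ⊛ H

  private
    X₀≡0 : NoConstantTerm X
    X₀≡0 _ = refl

  H≈1+H⁺ : H ≈ one ⊕ H⁺
  H≈1+H⁺ = geometric-unfold (X ⊛ G) (⊛-noConstantTerm X G X₀≡0)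

  H⁺-recurrence : H⁺ ≈ X ⊛ H ⊕ X ⊛ (E ⊛ H⁺)
  H⁺-recurrence = begin
    (X ⊛ G) ⊛ H                        ≈⟨ ⊛-assoc X G H ⟩
    X ⊛ (G ⊛ H)                        ≈⟨ ⊛-congʳ X G⊛H ⟩
    X ⊛ (H ⊕ E ⊛ H⁺)                   ≈⟨ ⊛-distribˡ-⊕ X H (E ⊛ H⁺) ⟩
    X ⊛ H ⊕ X ⊛ (E ⊛ H⁺)               ∎
    where
    open ≈-Reasoning
    G⊛H : G ⊛ H ≈ H ⊕ E ⊛ H⁺
    G⊛H = begin
      G ⊛ H                            ≈⟨ ⊛-congˡ H (geometric-unfold (X ⊛ E) (⊛-noConstantTerm X E X₀≡0)) ⟩
      (one ⊕ (X ⊛ E) ⊛ G) ⊛ H          ≈⟨ ⊛-distribʳ-⊕ one ((X ⊛ E) ⊛ G) H ⟩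
      one ⊛ H ⊕ ((X ⊛ E) ⊛ G) ⊛ H      ≈⟨ ⊕-cong (⊛-identityˡ H) (⊛-assoc (X ⊛ E) G H) ⟩
      H ⊕ (X ⊛ E) ⊛ (G ⊛ H)            ≈⟨ ⊕-congʳ H (⊛-congˡ (G ⊛ H) (⊛-comm X E)) ⟩
      H ⊕ (E ⊛ X) ⊛ (G ⊛ H)            ≈⟨ ⊕-congʳ H (⊛-assoc E X (G ⊛ H)) ⟩
      H ⊕ E ⊛ (X ⊛ (G ⊛ H))            ≈⟨ ⊕-congʳ H (⊛-congʳ E (⊛-assoc X G H)) ⟨
      H ⊕ E ⊛ H⁺                       ∎

  H⁺-zero : ∀ e → H⁺ 0 e ≡ 0
  H⁺-zero = ⊛-noConstantTerm (X ⊛ G) H (⊛-noConstantTerm X G X₀≡0)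

  H⁺-suc : ∀ a e → H⁺ (suc a) e ≡ H (suc a) e
  H⁺-suc a e = sym (H≈1+H⁺ (suc a) e)

  H-suc-≤ : ∀ n d → j ≤ d → H (suc n) d ≡ H n (d ∸ j) + (E ⊛ H⁺) n (d ∸ j)
  H-suc-≤ n d j≤d =
    trans (H≈1+H⁺ (suc n) d)
          (trans (H⁺-recurrence (suc n) d)
                 (cong₂ _+_ (zq^-⊛-≤ j H n d j≤d) (zq^-⊛-≤ j (E ⊛ H⁺) n d j≤d)))

  H-suc-> : ∀ n d → d < j → H (suc n) d ≡ 0
  H-suc-> n d d<j =
    trans (H≈1+H⁺ (suc n) d)
          (trans (H⁺-recurrence (suc n) d)
                 (cong₂ _+_ (zq^-⊛-> j H n d d<j) (zq^-⊛-> j (E ⊛ H⁺) n d d<j)))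

conv-twoLevels : ∀ m j → conv (suc (suc m)) (j * 2) ≈ TwoLevels.H j (conv m (suc j * 2))
conv-twoLevels m j =
  inv1-cong (⊛-cong (λ a b → cong (λ e → zq^ e a b) (m*n/n≡m j 2))
             (inv1-cong (⊛-congˡ (conv m (suc j * 2)) (λ a b → cong (λ e → zq^ e a b) ⌊1+2j/2⌋≡j))))
  where
  ⌊1+2j/2⌋≡j : suc (j * 2) / 2 ≡ j
  ⌊1+2j/2⌋≡j = trans (+-distrib-/-∣ʳ 1 {j * 2} {2} (divides-refl j)) (m*n/n≡m j 2)

-- Statistics of lists of naturals

<ᵇ-true : ∀ {m n} → m < n → (m <ᵇ n) ≡ true
<ᵇ-true {zero}  {suc n} _         = refl
<ᵇ-true {suc m} {suc n} (s≤s m<n) = <ᵇ-true m<n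

<ᵇ-false : ∀ {m n} → n ≤ m → (m <ᵇ n) ≡ false
<ᵇ-false {m}     {zero}  _         = refl
<ᵇ-false {suc m} {suc n} (s≤s n≤m) = <ᵇ-false n≤m

<ᵇ-false⁻ : ∀ m n → (m <ᵇ n) ≡ false → n ≤ m
<ᵇ-false⁻ m       zero    _  = z≤n
<ᵇ-false⁻ (suc m) (suc n) eq = s≤s (<ᵇ-false⁻ m n eq)

≡ᵇ-refl : ∀ n → (n ≡ᵇ n) ≡ true
≡ᵇ-refl zero    = refl
≡ᵇ-refl (suc n) = ≡ᵇ-refl n

≡ᵇ-true⁻ : ∀ m n → (m ≡ᵇ n) ≡ true → m ≡ n
≡ᵇ-true⁻ m n eq = ≡ᵇ⇒≡ m n (subst T (sym eq) _)

≡ᵇ-false : ∀ {m n} → m ≢ n → (m ≡ᵇ n) ≡ false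
≡ᵇ-false {zero}  {zero}  m≢n = contradiction refl m≢n
≡ᵇ-false {zero}  {suc n} _   = refl
≡ᵇ-false {suc m} {zero}  _   = refl
≡ᵇ-false {suc m} {suc n} m≢n = ≡ᵇ-false (m≢n ∘ cong suc)

≡ᵇ-false⁻ : ∀ m n → (m ≡ᵇ n) ≡ false → m ≢ n
≡ᵇ-false⁻ m n eq m≡n = subst T eq (≡⇒≡ᵇ m n m≡n)

count : (ℕ → Bool) → List ℕ → ℕ
count p []       = 0
count p (x ∷ xs) = if p x then suc (count p xs) else count p xs

count-cong : ∀ {p q} xs → (∀ z → p z ≡ q z) → count p xs ≡ count q xs
count-cong         []       p≗q = refl
count-cong {q = q} (x ∷ xs) p≗q rewrite p≗q x with q x
... | true  = cong suc (count-cong xs p≗q)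
... | false = count-cong xs p≗q

count-++ : ∀ p xs ys → count p (xs ++ ys) ≡ count p xs + count p ys
count-++ p []       ys = refl
count-++ p (x ∷ xs) ys with p x
... | true  = cong suc (count-++ p xs ys)
... | false = count-++ p xs ys

count-map : ∀ p f xs → count p (map f xs) ≡ count (p ∘ f) xs
count-map p f []       = refl
count-map p f (x ∷ xs) with p (f x)
... | true  = cong suc (count-map p f xs)
... | false = count-map p f xs

count-none : ∀ p {xs} → All (λ z → p z ≡ false) xs → count p xs ≡ 0
count-none p []                 = refl
count-none p {x ∷ _} (px ∷ pxs) rewrite px = count-none p pxs

count-none⁻ : ∀ p xs → count p xs ≡ 0 → All (λ z → p z ≡ false) xs
count-none⁻ p []       _  = []
count-none⁻ p (x ∷ xs) eq with p x in px
... | false = px ∷ count-none⁻ p xs eq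

count-all : ∀ p {xs} → All (λ z → p z ≡ true) xs → count p xs ≡ length xs
count-all p []                 = refl
count-all p {x ∷ _} (px ∷ pxs) rewrite px = cong suc (count-all p pxs)

repeats : List ℕ → ℕ
repeats []       = 0
repeats (x ∷ xs) = count (x ≡ᵇ_) xs + repeats xs

count231-from : ℕ → List ℕ → ℕ
count231-from x []       = 0
count231-from x (y ∷ zs) = (if x <ᵇ y then count (_<ᵇ x) zs else 0) + count231-from x zs

count231 : List ℕ → ℕ
count231 []       = 0
count231 (x ∷ xs) = count231-from x xs + count231 xs

between : ℕ → ℕ → ℕ → Bool
between x y z = (x <ᵇ z) ∧ (z <ᵇ y)

count13-2 : List ℕ → ℕ
count13-2 []           = 0
count13-2 (x ∷ [])     = 0
count13-2 (x ∷ y ∷ zs) = count (between x y) zs + count13-2 (y ∷ zs)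

remove : ℕ → List ℕ → List ℕ
remove h []       = []
remove h (x ∷ xs) = if h ≡ᵇ x then remove h xs else x ∷ remove h xs

length-remove : ∀ h xs → length xs ≡ length (remove h xs) + count (h ≡ᵇ_) xs
length-remove h []       = refl
length-remove h (x ∷ xs) with h ≡ᵇ x
... | true  = trans (cong suc (length-remove h xs)) (sym (+-suc _ _))
... | false = cong suc (length-remove h xs)

count-≤-∷ : ∀ p x xs → count p xs ≤ count p (x ∷ xs)
count-≤-∷ p x xs with p x
... | true  = n≤1+n _
... | false = ≤-refl

count-remove : ∀ p h xs → count p (remove h xs) ≤ count p xs
count-remove p h []       = z≤n
count-remove p h (x ∷ xs) with h ≡ᵇ x
... | true  = ≤-trans (count-remove p h xs) (count-≤-∷ p x xs)
... | false with p x
...   | true  = s≤s (count-remove p h xs)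
...   | false = count-remove p h xs

repeats-remove : ∀ h xs → repeats (remove h xs) ≤ repeats xs
repeats-remove h []       = z≤n
repeats-remove h (x ∷ xs) with h ≡ᵇ x
... | true  = ≤-trans (repeats-remove h xs) (m≤n+m _ _)
... | false = +-mono-≤ (count-remove _ h xs) (repeats-remove h xs)

remove-avoids : ∀ {P : ℕ → Set} h {xs} → All P xs → All (λ z → P z × h ≢ z) (remove h xs)
remove-avoids h {[]}     []         = []
remove-avoids h {x ∷ xs} (px ∷ pxs) with h ≡ᵇ x in h≡ᵇx
... | true  = remove-avoids h pxs
... | false = (px , ≡ᵇ-false⁻ h x h≡ᵇx) ∷ remove-avoids h pxs

distinct⇒count≤1 : ∀ h xs → repeats xs ≡ 0 → count (h ≡ᵇ_) xs ≤ 1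
distinct⇒count≤1 h []       _     = z≤n
distinct⇒count≤1 h (x ∷ xs) rep≡0 with h ≡ᵇ x in h≡ᵇx
... | true  rewrite ≡ᵇ-true⁻ h x h≡ᵇx = s≤s (≤-reflexive (m+n≡0⇒m≡0 _ rep≡0))
... | false = distinct⇒count≤1 h xs (m+n≡0⇒n≡0 _ rep≡0)

pigeonhole : ∀ lo hi xs → repeats xs ≡ 0 → All (λ z → lo ≤ z × z < hi) xs → length xs ≤ hi ∸ lo
pigeonhole lo zero    []       _     _                     = z≤n
pigeonhole lo zero    (x ∷ xs) _     ((_ , ()) ∷ _)
pigeonhole lo (suc h) []       _     _                     = z≤n
pigeonhole lo (suc h) (x ∷ xs) rep≡0 in-range@((lo≤x , x<1+h) ∷ _) = begin
  length (x ∷ xs)                                        ≡⟨ length-remove h (x ∷ xs) ⟩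
  length (remove h (x ∷ xs)) + count (h ≡ᵇ_) (x ∷ xs)
    ≤⟨ +-mono-≤ rest (distinct⇒count≤1 h (x ∷ xs) rep≡0) ⟩
  h ∸ lo + 1                                             ≡⟨ +-comm (h ∸ lo) 1 ⟩
  suc (h ∸ lo)                                           ≡⟨ +-∸-assoc 1 lo≤h ⟨
  suc h ∸ lo                                             ∎
  where
  open ≤-Reasoning
  lo≤h : lo ≤ h
  lo≤h = ≤-trans lo≤x (≤-pred x<1+h)
  rest : length (remove h (x ∷ xs)) ≤ h ∸ lo
  rest = pigeonhole lo h (remove h (x ∷ xs))
           (n≤0⇒n≡0 (≤-trans (repeats-remove h (x ∷ xs)) (≤-reflexive rep≡0)))
           (All.map (λ ((lo≤z , z<1+h) , h≢z) → lo≤z , ≤∧≢⇒< (≤-pred z<1+h) (h≢z ∘ sym))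
                    (remove-avoids h in-range))

repeats-between : List ℕ → List ℕ → ℕ
repeats-between []       ys = 0
repeats-between (x ∷ xs) ys = count (x ≡ᵇ_) ys + repeats-between xs ys

repeats-++ : ∀ xs ys → repeats (xs ++ ys) ≡ repeats xs + repeats ys + repeats-between xs ys
repeats-++ []       ys = sym (+-identityʳ (repeats ys))
repeats-++ (x ∷ xs) ys =
  trans (cong₂ _+_ (count-++ (x ≡ᵇ_) xs ys) (repeats-++ xs ys))
        (regroup (count (x ≡ᵇ_) xs) (count (x ≡ᵇ_) ys) (repeats xs) (repeats ys) (repeats-between xs ys))
  where
  regroup : ∀ a b c d e → a + b + (c + d + e) ≡ a + c + d + (b + e)
  regroup = solve-∀

repeats-++-zero : ∀ xs ys → repeats (xs ++ ys) ≡ 0 →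
                  repeats xs ≡ 0 × repeats ys ≡ 0 × repeats-between xs ys ≡ 0
repeats-++-zero xs ys eq = m+n≡0⇒m≡0 _ parts , m+n≡0⇒n≡0 (repeats xs) parts , m+n≡0⇒n≡0 _ total
  where
  total : repeats xs + repeats ys + repeats-between xs ys ≡ 0
  total = trans (sym (repeats-++ xs ys)) eq
  parts : repeats xs + repeats ys ≡ 0
  parts = m+n≡0⇒m≡0 _ total

count231-from-++ : ∀ x ys zs →
  count231-from x (ys ++ zs) ≡ count231-from x ys + count231-from x zs + count (x <ᵇ_) ys * count (_<ᵇ x) zs
count231-from-++ x []       zs = sym (+-identityʳ _)
count231-from-++ x (y ∷ ys) zs with x <ᵇ y
... | true  = trans (cong₂ _+_ (count-++ (_<ᵇ x) ys zs) (count231-from-++ x ys zs))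
                    (regroup (count (_<ᵇ x) ys) (count (_<ᵇ x) zs) (count231-from x ys) (count231-from x zs)
                             (count (x <ᵇ_) ys))
  where
  regroup : ∀ a b c d k → a + b + (c + d + k * b) ≡ a + c + d + (b + k * b)
  regroup = solve-∀
... | false = count231-from-++ x ys zs

count231-between : List ℕ → List ℕ → ℕ
count231-between []       ys = 0
count231-between (x ∷ xs) ys =
  count231-from x ys + count (x <ᵇ_) xs * count (_<ᵇ x) ys + count231-between xs ys

count231-++ : ∀ xs ys → count231 (xs ++ ys) ≡ count231 xs + count231 ys + count231-between xs ys
count231-++ []       ys = sym (+-identityʳ (count231 ys))
count231-++ (x ∷ xs) ys =
  trans (cong₂ _+_ (count231-from-++ x xs ys) (count231-++ xs ys))
        (regroup (count231-from x xs) (count231-from x ys) (count (x <ᵇ_) xs * count (_<ᵇ x) ys)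
                 (count231 xs) (count231 ys) (count231-between xs ys))
  where
  regroup : ∀ a b c d e f → a + b + c + (d + e + f) ≡ a + d + e + (b + c + f)
  regroup = solve-∀

count231-++-zero : ∀ xs ys → count231 (xs ++ ys) ≡ 0 →
                   count231 xs ≡ 0 × count231 ys ≡ 0 × count231-between xs ys ≡ 0
count231-++-zero xs ys eq = m+n≡0⇒m≡0 _ parts , m+n≡0⇒n≡0 (count231 xs) parts , m+n≡0⇒n≡0 _ total
  where
  total : count231 xs + count231 ys + count231-between xs ys ≡ 0
  total = trans (sym (count231-++ xs ys)) eq
  parts : count231 xs + count231 ys ≡ 0
  parts = m+n≡0⇒m≡0 _ total

count231-from-nothing-below : ∀ x zs → count (_<ᵇ x) zs ≡ 0 → count231-from x zs ≡ 0
count231-from-nothing-below x []       _ = refl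
count231-from-nothing-below x (y ∷ zs) none with y <ᵇ x
... | false with x <ᵇ y
...   | true  = trans (cong (_+ count231-from x zs) none) (count231-from-nothing-below x zs none)
...   | false = count231-from-nothing-below x zs none

count231-from-nothing-above : ∀ x zs → count (x <ᵇ_) zs ≡ 0 → count231-from x zs ≡ 0
count231-from-nothing-above x []       _ = refl
count231-from-nothing-above x (y ∷ zs) none with x <ᵇ y
... | false = count231-from-nothing-above x zs none

repeats-between-separated : ∀ t {xs ys} → All (_< t) xs → All (t ≤_) ys → repeats-between xs ys ≡ 0
repeats-between-separated t []           t≤ys = refl
repeats-between-separated t (x<t ∷ xs<t) t≤ys =
  cong₂ _+_ (count-none _ (All.map (λ t≤y → ≡ᵇ-false (<⇒≢ (<-≤-trans x<t t≤y))) t≤ys))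
            (repeats-between-separated t xs<t t≤ys)

count231-between-separated : ∀ t {xs ys} → All (_< t) xs → All (t ≤_) ys → count231-between xs ys ≡ 0
count231-between-separated t                  []           t≤ys = refl
count231-between-separated t {x ∷ xs} {ys} (x<t ∷ xs<t) t≤ys =
  cong₂ _+_ (cong₂ _+_ (count231-from-nothing-below x ys nothing-below)
                       (trans (cong (count (x <ᵇ_) xs *_) nothing-below) (*-zeroʳ (count (x <ᵇ_) xs))))
            (count231-between-separated t xs<t t≤ys)
  where
  nothing-below : count (_<ᵇ x) ys ≡ 0
  nothing-below = count-none _ (All.map (λ t≤y → <ᵇ-false (≤-trans (<⇒≤ x<t) t≤y)) t≤ys)

repeats-between-zero⁻ : ∀ xs ys → repeats-between xs ys ≡ 0 → All (λ x → All (x ≢_) ys) xs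
repeats-between-zero⁻ []       ys _     = []
repeats-between-zero⁻ (x ∷ xs) ys rep≡0 =
  All.map (λ {z} → ≡ᵇ-false⁻ x z) (count-none⁻ _ ys (m+n≡0⇒m≡0 _ rep≡0)) ∷
  repeats-between-zero⁻ xs ys (m+n≡0⇒n≡0 _ rep≡0)

-- An occurrence x n z with z < x would be a 2-3-1.
count231-between-max⁻ : ∀ n xs ys → All (_< n) xs → count231-between xs (n ∷ ys) ≡ 0 →
                        All (λ x → All (x ≤_) ys) xs
count231-between-max⁻ n []       ys []           _  = []
count231-between-max⁻ n (x ∷ xs) ys (x<n ∷ xs<n) c≡0 =
  All.map (λ {z} → <ᵇ-false⁻ z x) (count-none⁻ _ ys below-x≡0) ∷
  count231-between-max⁻ n xs ys xs<n (m+n≡0⇒n≡0 _ c≡0)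
  where
  below-x≡0 : count (_<ᵇ x) ys ≡ 0
  below-x≡0 = m+n≡0⇒m≡0 _ (subst (λ b → (if b then count (_<ᵇ x) ys else 0) + count231-from x ys ≡ 0)
                                 (<ᵇ-true x<n) (m+n≡0⇒m≡0 _ (m+n≡0⇒m≡0 _ c≡0)))

count13-2-max-head : ∀ n {γ} → All (_< n) γ → count13-2 (n ∷ γ) ≡ count13-2 γ
count13-2-max-head n {[]}    _            = refl
count13-2-max-head n {y ∷ γ} (_ ∷ γ<n) =
  cong (_+ count13-2 (y ∷ γ))
       (count-none _ (All.map (λ {z} z<n → cong (_∧ (z <ᵇ y)) (<ᵇ-false (<⇒≤ z<n))) γ<n))

-- Each element of γ lies between the last letter of x ∷ α and n.
count13-2-glue : ∀ t n x α γ → All (_< t) (x ∷ α) → All (λ y → t ≤ y × y < n) γ → t ≤ n →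
                 count13-2 (x ∷ α ++ n ∷ γ) ≡ count13-2 (x ∷ α) + (count13-2 γ + length γ)
count13-2-glue t n x []       γ (x<t ∷ []) t≤γ<n t≤n =
  trans (cong₂ _+_ (count-all _ (All.map (λ (t≤z , z<n) → cong₂ _∧_ (<ᵇ-true (<-≤-trans x<t t≤z)) (<ᵇ-true z<n))
                                          t≤γ<n))
                   (count13-2-max-head n (All.map proj₂ t≤γ<n)))
        (+-comm (length γ) (count13-2 γ))
count13-2-glue t n x (x′ ∷ α) γ (x<t ∷ x′<t ∷ α<t) t≤γ<n t≤n =
  trans (cong₂ _+_ (trans (count-++ _ α (n ∷ γ)) (cong (count (between x x′) α +_) none-after))
                   (count13-2-glue t n x′ α γ (x′<t ∷ α<t) t≤γ<n t≤n))
        (trans (cong (_+ (count13-2 (x′ ∷ α) + (count13-2 γ + length γ))) (+-identityʳ (count (between x x′) α)))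
               (sym (+-assoc (count (between x x′) α) (count13-2 (x′ ∷ α)) _)))
  where
  above-x′ : ∀ {z} → t ≤ z → between x x′ z ≡ false
  above-x′ {z} t≤z = trans (cong ((x <ᵇ z) ∧_) (<ᵇ-false (≤-trans (<⇒≤ x′<t) t≤z))) (∧-zeroʳ (x <ᵇ z))
  none-after : count (between x x′) (n ∷ γ) ≡ 0
  none-after = count-none _ (above-x′ t≤n ∷ All.map (above-x′ ∘ proj₁) t≤γ<n)

+-<ᵇ : ∀ c m n → (c + m <ᵇ c + n) ≡ (m <ᵇ n)
+-<ᵇ zero    m n = refl
+-<ᵇ (suc c) m n = +-<ᵇ c m n

+-≡ᵇ : ∀ c m n → (c + m ≡ᵇ c + n) ≡ (m ≡ᵇ n)
+-≡ᵇ zero    m n = refl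
+-≡ᵇ (suc c) m n = +-≡ᵇ c m n

map-∸-map-+ : ∀ c xs → map (_∸ c) (map (c +_) xs) ≡ xs
map-∸-map-+ c []       = refl
map-∸-map-+ c (x ∷ xs) = cong₂ _∷_ (m+n∸m≡n c x) (map-∸-map-+ c xs)

repeats-shift : ∀ c xs → repeats (map (c +_) xs) ≡ repeats xs
repeats-shift c []       = refl
repeats-shift c (x ∷ xs) =
  cong₂ _+_ (trans (count-map _ (c +_) xs) (count-cong xs (+-≡ᵇ c x))) (repeats-shift c xs)

count231-from-shift : ∀ c x ys → count231-from (c + x) (map (c +_) ys) ≡ count231-from x ys
count231-from-shift c x []       = refl
count231-from-shift c x (y ∷ ys) rewrite +-<ᵇ c x y with x <ᵇ y
... | true  = cong₂ _+_ (trans (count-map _ (c +_) ys) (count-cong ys (λ z → +-<ᵇ c z x)))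
                        (count231-from-shift c x ys)
... | false = count231-from-shift c x ys

count231-shift : ∀ c xs → count231 (map (c +_) xs) ≡ count231 xs
count231-shift c []       = refl
count231-shift c (x ∷ xs) = cong₂ _+_ (count231-from-shift c x xs) (count231-shift c xs)

count13-2-shift : ∀ c xs → count13-2 (map (c +_) xs) ≡ count13-2 xs
count13-2-shift c []           = refl
count13-2-shift c (x ∷ [])     = refl
count13-2-shift c (x ∷ y ∷ zs) =
  cong₂ _+_ (trans (count-map _ (c +_) zs) (count-cong zs (λ z → cong₂ _∧_ (+-<ᵇ c x z) (+-<ᵇ c z y))))
            (count13-2-shift c (y ∷ zs))

-- 2-3-1-avoiding permutations, split at their maximum

record IsPerm231 (n s : ℕ) (σ : List ℕ) : Set where
  constructor isPerm231
  field
    length≡   : length σ ≡ n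
    bounded   : All (_< n) σ
    distinct  : repeats σ ≡ 0
    avoids231 : count231 σ ≡ 0
    count13-2≡ : count13-2 σ ≡ s

Perm231 : ℕ → ℕ → Set
Perm231 n s = Σ (List ℕ) (IsPerm231 n s)

IsPerm231-irrelevant : ∀ {n s σ} (p q : IsPerm231 n s σ) → p ≡ q
IsPerm231-irrelevant (isPerm231 l b d a c) (isPerm231 l′ b′ d′ a′ c′)
  rewrite ≡-irrelevant l l′ | All.irrelevant (λ p q → <-irrelevant p q) b b′
        | ≡-irrelevant d d′ | ≡-irrelevant a a′ | ≡-irrelevant c c′ = refl

Perm231-≡ : ∀ {n s xs ys} → xs ≡ ys → (p : IsPerm231 n s xs) (q : IsPerm231 n s ys) →
            _≡_ {A = Perm231 n s} (xs , p) (ys , q)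
Perm231-≡ refl p q = cong (_ ,_) (IsPerm231-irrelevant p q)

count-absent : ∀ {n xs} → All (_< n) xs → count (n ≡ᵇ_) xs ≡ 0
count-absent xs<n = count-none _ (All.map (≡ᵇ-false ∘ >⇒≢) xs<n)

absent⇒below : ∀ {n xs} → count (n ≡ᵇ_) xs ≡ 0 → All (_< suc n) xs → All (_< n) xs
absent⇒below {n} {xs} n∉xs xs<1+n =
  All.zipWith (λ (z<1+n , n≢ᵇz) → ≤∧≢⇒< (≤-pred z<1+n) (≡ᵇ-false⁻ n _ n≢ᵇz ∘ sym))
              (xs<1+n , count-none⁻ _ xs n∉xs)

contains-max : ∀ {n s σ} → IsPerm231 (suc n) s σ → count (n ≡ᵇ_) σ ≢ 0
contains-max {n} {σ = σ} (isPerm231 length≡ bounded distinct _ _) n∉σ =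
  <-irrefl refl (subst (_≤ n) length≡ (pigeonhole 0 n σ distinct (All.map (z≤n ,_) (absent⇒below n∉σ bounded))))

cons-max : ∀ {n s β} → IsPerm231 n s β → IsPerm231 (suc n) s (n ∷ β)
cons-max {n} {β = β} (isPerm231 length≡ bounded distinct avoids231 count13-2≡) = isPerm231
  (cong suc length≡)
  (≤-refl ∷ All.map m<n⇒m<1+n bounded)
  (trans (cong (_+ repeats β) (count-absent bounded)) distinct)
  (trans (cong (_+ count231 β) (count231-from-nothing-above n β (count-none _ (All.map (<ᵇ-false ∘ <⇒≤) bounded))))
         avoids231)
  (trans (count13-2-max-head n bounded) count13-2≡)

cons-max⁻ : ∀ {n s β} → IsPerm231 (suc n) s (n ∷ β) → IsPerm231 n s β
cons-max⁻ {n} {β = β} (isPerm231 length≡ (_ ∷ bounded) distinct avoids231 count13-2≡) = isPerm231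
  (suc-injective length≡)
  β<n
  (m+n≡0⇒n≡0 _ distinct)
  (m+n≡0⇒n≡0 _ avoids231)
  (trans (sym (count13-2-max-head n β<n)) count13-2≡)
  where
  β<n : All (_< n) β
  β<n = absent⇒below (m+n≡0⇒m≡0 _ distinct) bounded

glue-absent : ∀ {a b n s₁ α} → suc a + b ≡ n → IsPerm231 (suc a) s₁ α → count (n ≡ᵇ_) α ≡ 0
glue-absent {a} {b} A+b≡n perm =
  count-absent (All.map (λ z<A → <-≤-trans z<A (subst (suc a ≤_) A+b≡n (m≤m+n (suc a) b)))
                        (IsPerm231.bounded perm))

glue : ∀ {a b n s₁ s₂ α β′} → suc a + b ≡ n → IsPerm231 (suc a) s₁ α → IsPerm231 b s₂ β′ →
       IsPerm231 (suc n) (s₁ + (s₂ + b)) (α ++ n ∷ map (suc a +_) β′)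
glue {a} {b} {n} {α = x ∷ α′} {β′} A+b≡n
     (isPerm231 refl α<A distinctα avoidsα refl) (isPerm231 refl β′<b distinctβ′ avoidsβ′ refl) = isPerm231
  (trans (length-++ α) (trans (cong (λ m → A + suc m) (length-map (A +_) β′)) (trans (+-suc A b) (cong suc A+b≡n))))
  (++⁺ (All.map (λ z<A → m<n⇒m<1+n (<-≤-trans z<A A≤n)) α<A)
       (≤-refl ∷ All.map (m<n⇒m<1+n ∘ proj₂) A≤γ<n))
  (trans (repeats-++ α (n ∷ γ))
         (cong₂ _+_ (cong₂ _+_ distinctα
                               (cong₂ _+_ (count-absent γ<n) (trans (repeats-shift A β′) distinctβ′)))
                    (repeats-between-separated A α<A A≤nγ)))
  (trans (count231-++ α (n ∷ γ))
         (cong₂ _+_ (cong₂ _+_ avoidsα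
                               (cong₂ _+_ (count231-from-nothing-above n γ
                                             (count-none _ (All.map (<ᵇ-false ∘ <⇒≤) γ<n)))
                                          (trans (count231-shift A β′) avoidsβ′)))
                    (count231-between-separated A α<A A≤nγ)))
  (trans (count13-2-glue A n x α′ γ α<A A≤γ<n A≤n)
         (cong₂ (λ m k → count13-2 α + (m + k)) (count13-2-shift A β′) (length-map (A +_) β′)))
  where
  A : ℕ
  A = suc a
  α : List ℕ
  α = x ∷ α′
  γ : List ℕ
  γ = map (A +_) β′
  A≤n : A ≤ n
  A≤n = subst (A ≤_) A+b≡n (m≤m+n A b)
  A≤γ<n : All (λ z → A ≤ z × z < n) γ
  A≤γ<n = map⁺ (All.map (λ {z} z<b → m≤m+n A z , subst (A + z <_) A+b≡n (+-monoʳ-< A z<b)) β′<b)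
  γ<n : All (_< n) γ
  γ<n = All.map proj₂ A≤γ<n
  A≤nγ : All (A ≤_) (n ∷ γ)
  A≤nγ = A≤n ∷ All.map proj₁ A≤γ<n

transpose : ∀ {R : ℕ → ℕ → Set} xs ys → All (λ x → All (R x) ys) xs →
            All (λ y → All (λ x → R x y) xs) ys
transpose xs []       _    = []
transpose xs (y ∷ ys) Rxys = All.map All.head Rxys ∷ transpose xs ys (All.map All.tail Rxys)

separated-halves : ∀ n xs ys → repeats xs ≡ 0 → repeats ys ≡ 0 → All (_< n) xs → All (_< n) ys →
                   All (λ x → All (x <_) ys) xs → length xs + length ys ≡ n →
                   All (_< length xs) xs × All (length xs ≤_) ys
separated-halves n xs ys distinctxs distinctys xs<n ys<n xs<ys |xs|+|ys|≡n =
  All.zipWith below (xs<n , xs<ys) ,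
  All.map (λ {y} xs<y → pigeonhole 0 y xs distinctxs (All.map (z≤n ,_) xs<y)) (transpose xs ys xs<ys)
  where
  below : ∀ {x} → x < n × All (x <_) ys → x < length xs
  below {x} (x<n , x<ys) with x <? length xs
  ... | yes x<|xs| = x<|xs|
  ... | no  x≮|xs| = contradiction n<n (<-irrefl refl)
    where
    open ≤-Reasoning
    |ys|≤n∸1+x : length ys ≤ n ∸ suc x
    |ys|≤n∸1+x = pigeonhole (suc x) n ys distinctys (All.zip (x<ys , ys<n))
    n<n : n < n
    n<n = begin-strict
      n                                ≡⟨ |xs|+|ys|≡n ⟨
      length xs + length ys            ≤⟨ +-mono-≤ (≮⇒≥ x≮|xs|) |ys|≤n∸1+x ⟩
      x + (n ∸ suc x)                  <⟨ n<1+n _ ⟩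
      suc x + (n ∸ suc x)              ≡⟨ m+[n∸m]≡n x<n ⟩
      n                                ∎

module Unglue {n s : ℕ} (x : ℕ) (α β : List ℕ) (n∉α : count (n ≡ᵇ_) (x ∷ α) ≡ 0)
              (perm : IsPerm231 (suc n) s (x ∷ α ++ n ∷ β)) where

  open IsPerm231 perm

  A : ℕ
  A = length (x ∷ α)

  β′ : List ℕ
  β′ = map (_∸ A) β

  A+|β|≡n : A + length β ≡ n
  A+|β|≡n = suc-injective (trans (sym (+-suc A (length β))) (trans (sym (length-++ (x ∷ α))) length≡))

  private
    split-repeats : repeats (x ∷ α) ≡ 0 × repeats (n ∷ β) ≡ 0 × repeats-between (x ∷ α) (n ∷ β) ≡ 0
    split-repeats = repeats-++-zero (x ∷ α) (n ∷ β) distinct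

    split-avoids : count231 (x ∷ α) ≡ 0 × count231 (n ∷ β) ≡ 0 × count231-between (x ∷ α) (n ∷ β) ≡ 0
    split-avoids = count231-++-zero (x ∷ α) (n ∷ β) avoids231

    distinctα : repeats (x ∷ α) ≡ 0
    distinctα = proj₁ split-repeats

    n∉β : count (n ≡ᵇ_) β ≡ 0
    n∉β = m+n≡0⇒m≡0 _ (proj₁ (proj₂ split-repeats))

    distinctβ : repeats β ≡ 0
    distinctβ = m+n≡0⇒n≡0 (count (n ≡ᵇ_) β) (proj₁ (proj₂ split-repeats))

    avoidsα : count231 (x ∷ α) ≡ 0
    avoidsα = proj₁ split-avoids

    avoidsβ : count231 β ≡ 0
    avoidsβ = m+n≡0⇒n≡0 (count231-from n β) (proj₁ (proj₂ split-avoids))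

    α<n : All (_< n) (x ∷ α)
    α<n = absent⇒below n∉α (++⁻ˡ (x ∷ α) bounded)

    β<n : All (_< n) β
    β<n = absent⇒below n∉β (All.tail (++⁻ʳ (x ∷ α) bounded))

    α<β : All (λ y → All (y <_) β) (x ∷ α)
    α<β = All.zipWith (λ (y≤β , y≢nβ) → All.zipWith (λ (y≤z , y≢z) → ≤∧≢⇒< y≤z y≢z)
                                                    (y≤β , All.tail y≢nβ))
      (count231-between-max⁻ n (x ∷ α) β α<n (proj₂ (proj₂ split-avoids)) ,
       repeats-between-zero⁻ (x ∷ α) (n ∷ β) (proj₂ (proj₂ split-repeats)))

    halves : All (_< A) (x ∷ α) × All (A ≤_) β
    halves = separated-halves n (x ∷ α) β distinctα distinctβ α<n β<n α<β A+|β|≡n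

  shift-back : map (A +_) β′ ≡ β
  shift-back = trans (sym (map-∘ β)) (map-id-local (All.map m+[n∸m]≡n (proj₂ halves)))

  left : IsPerm231 A (count13-2 (x ∷ α)) (x ∷ α)
  left = isPerm231 refl (proj₁ halves) distinctα avoidsα refl

  right : IsPerm231 (length β) (count13-2 β′) β′
  right = isPerm231 (length-map (_∸ A) β)
    (map⁺ (All.zipWith (λ {z} (A≤z , z<n) → subst (z ∸ A <_) A+|β|∸A≡|β| (∸-monoˡ-< z<n A≤z))
                       (proj₂ halves , β<n)))
    (trans (sym (repeats-shift A β′)) (trans (cong repeats shift-back) distinctβ))
    (trans (sym (count231-shift A β′)) (trans (cong count231 shift-back) avoidsβ))
    refl
    where
    A+|β|∸A≡|β| : n ∸ A ≡ length β
    A+|β|∸A≡|β| = trans (cong (_∸ A) (sym A+|β|≡n)) (m+n∸m≡n A (length β))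

  s≡ : s ≡ count13-2 (x ∷ α) + (count13-2 β′ + length β)
  s≡ = trans (sym count13-2≡) (trans (count13-2-glue A n x α β (proj₁ halves) (All.zip (proj₂ halves , β<n)) A≤n)
             (cong (λ m → count13-2 (x ∷ α) + (m + length β)) (trans (cong count13-2 (sym shift-back))
                                                                      (count13-2-shift A β′))))
    where
    A≤n : A ≤ n
    A≤n = subst (A ≤_) A+|β|≡n (m≤m+n A (length β))

splitAtFirst : ℕ → List ℕ → List ℕ × List ℕ
splitAtFirst n []       = [] , []
splitAtFirst n (x ∷ xs) = if n ≡ᵇ x then ([] , xs) else Product.map₁ (x ∷_) (splitAtFirst n xs)

splitAtFirst-++ : ∀ n α β → count (n ≡ᵇ_) α ≡ 0 → splitAtFirst n (α ++ n ∷ β) ≡ (α , β)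
splitAtFirst-++ n []       β _   rewrite ≡ᵇ-refl n = refl
splitAtFirst-++ n (x ∷ α) β n∉α with n ≡ᵇ x
... | false = cong (Product.map₁ (x ∷_)) (splitAtFirst-++ n α β n∉α)

splitAtFirst-correct : ∀ n xs → count (n ≡ᵇ_) xs ≢ 0 →
  let (α , β) = splitAtFirst n xs in xs ≡ α ++ n ∷ β × count (n ≡ᵇ_) α ≡ 0
splitAtFirst-correct n []       n∈xs = contradiction refl n∈xs
splitAtFirst-correct n (x ∷ xs) n∈xs with n ≡ᵇ x in n≡ᵇx
... | true  = cong (_∷ xs) (sym (≡ᵇ-true⁻ n x n≡ᵇx)) , refl
... | false rewrite n≡ᵇx = Product.map (cong (x ∷_)) id (splitAtFirst-correct n xs n∈xs)

SplitAtFirst : ℕ → (List ℕ → Set) → Set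
SplitAtFirst n P = Σ[ α ∈ List ℕ ] Σ[ β ∈ List ℕ ] count (n ≡ᵇ_) α ≡ 0 × P (α ++ n ∷ β)

SplitAtFirst-≡ : ∀ n (P : List ℕ → Set) {α α′ β β′} → (∀ {xs} (p q : P xs) → p ≡ q) →
                 α ≡ α′ → β ≡ β′ → ∀ n∉α p n∉α′ p′ →
                 _≡_ {A = SplitAtFirst n P} (α , β , n∉α , p) (α′ , β′ , n∉α′ , p′)
SplitAtFirst-≡ n P P-irrelevant refl refl n∉α p n∉α′ p′ =
  cong₂ (λ u v → _ , _ , u , v) (≡-irrelevant n∉α n∉α′) (P-irrelevant p p′)

splitAtFirst-↔ : ∀ n {P : List ℕ → Set} → (∀ {xs} (p q : P xs) → p ≡ q) →
                 (∀ {xs} → P xs → count (n ≡ᵇ_) xs ≢ 0) → Σ (List ℕ) P ↔ SplitAtFirst n P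
splitAtFirst-↔ n {P} P-irrelevant P⇒n∈ = mk↔ₛ′ to from to∘from from∘to
  where
  to : Σ (List ℕ) P → SplitAtFirst n P
  to (xs , p) = let (xs≡ , n∉α) = splitAtFirst-correct n xs (P⇒n∈ p)
                in proj₁ (splitAtFirst n xs) , proj₂ (splitAtFirst n xs) , n∉α , subst P xs≡ p
  from : SplitAtFirst n P → Σ (List ℕ) P
  from (α , β , _ , p) = α ++ n ∷ β , p
  to∘from : ∀ r → to (from r) ≡ r
  to∘from (α , β , n∉α , p) =
    SplitAtFirst-≡ n P P-irrelevant (cong proj₁ split≡) (cong proj₂ split≡) _ _ _ _
    where
    split≡ : splitAtFirst n (α ++ n ∷ β) ≡ (α , β)
    split≡ = splitAtFirst-++ n α β n∉α
  from∘to : ∀ q → from (to q) ≡ q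
  from∘to (xs , p) = same-list (sym (proj₁ (splitAtFirst-correct n xs (P⇒n∈ p)))) _ _
    where
    same-list : ∀ {ys zs} → ys ≡ zs → ∀ p q → _≡_ {A = Σ (List ℕ) P} (ys , p) (zs , q)
    same-list refl p q = cong (_ ,_) (P-irrelevant p q)

Glued : ℕ → ℕ → Set
Glued n s = Σ[ a ∈ ℕ ] Σ[ b ∈ ℕ ] Σ[ s₁ ∈ ℕ ] Σ[ s₂ ∈ ℕ ]
            (suc a + b ≡ n) × (s ≡ s₁ + (s₂ + b)) × Perm231 (suc a) s₁ × Perm231 b s₂

Glued-≡ : ∀ {n s a a′ b b′ s₁ s₁′ s₂ s₂′ α α′ β β′} →
          a ≡ a′ → b ≡ b′ → s₁ ≡ s₁′ → s₂ ≡ s₂′ → α ≡ α′ → β ≡ β′ →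
          ∀ e₁ e₂ p q e₁′ e₂′ p′ q′ →
          _≡_ {A = Glued n s} (a , b , s₁ , s₂ , e₁ , e₂ , (α , p) , (β , q))
                              (a′ , b′ , s₁′ , s₂′ , e₁′ , e₂′ , (α′ , p′) , (β′ , q′))
Glued-≡ refl refl refl refl refl refl e₁ e₂ p q e₁′ e₂′ p′ q′
  rewrite ≡-irrelevant e₁ e₁′ | ≡-irrelevant e₂ e₂′
        | IsPerm231-irrelevant p p′ | IsPerm231-irrelevant q q′ = refl

splitAtMax-↔ : ∀ n s → SplitAtFirst n (IsPerm231 (suc n) s) ↔ (Perm231 n s ⊎ Glued n s)
splitAtMax-↔ n s = mk↔ₛ′ to from to∘from from∘to
  where
  to : SplitAtFirst n (IsPerm231 (suc n) s) → Perm231 n s ⊎ Glued n s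
  to ([]    , β , _   , p) = inj₁ (β , cons-max⁻ p)
  to (x ∷ α , β , n∉α , p) =
    inj₂ (length α , length β , count13-2 (x ∷ α) , count13-2 β′ , A+|β|≡n , s≡ ,
          (x ∷ α , left) , (β′ , right))
    where open Unglue x α β n∉α p
  from : Perm231 n s ⊎ Glued n s → SplitAtFirst n (IsPerm231 (suc n) s)
  from (inj₁ (β , p)) = [] , β , refl , cons-max p
  from (inj₂ (a , b , s₁ , s₂ , A+b≡n , s≡ , (α , p) , (β′ , q))) =
    α , map (suc a +_) β′ , glue-absent A+b≡n p ,
    subst (λ t → IsPerm231 (suc n) t (α ++ n ∷ map (suc a +_) β′)) (sym s≡) (glue A+b≡n p q)
  to∘from : ∀ r → to (from r) ≡ r
  to∘from (inj₁ (β , p)) = cong (λ p′ → inj₁ (β , p′)) (IsPerm231-irrelevant _ _)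
  to∘from (inj₂ (a , b , s₁ , s₂ , _ , _ , ([] , isPerm231 () _ _ _ _) , _))
  to∘from (inj₂ (.(length α) , .(length β′) , .(count13-2 (x ∷ α)) , .(count13-2 β′) , A+b≡n , s≡ ,
                 (x ∷ α , isPerm231 refl _ _ _ refl) , (β′ , isPerm231 refl _ _ _ refl))) =
    cong inj₂ (Glued-≡ refl (length-map _ β′) refl (cong count13-2 (map-∸-map-+ (suc (length α)) β′)) refl
                       (map-∸-map-+ (suc (length α)) β′) _ _ _ _ _ _ _ _)
  from∘to : ∀ q → from (to q) ≡ q
  from∘to ([]    , β , n∉α , p) = SplitAtFirst-≡ n (IsPerm231 (suc n) s) IsPerm231-irrelevant refl refl _ _ _ _
  from∘to (x ∷ α , β , n∉α , p) = SplitAtFirst-≡ n (IsPerm231 (suc n) s) IsPerm231-irrelevant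
                                                 refl (Unglue.shift-back x α β n∉α p) _ _ _ _

Perm231-suc-↔ : ∀ n s → Perm231 (suc n) s ↔ (Perm231 n s ⊎ Glued n s)
Perm231-suc-↔ n s = ↔-trans (splitAtFirst-↔ n IsPerm231-irrelevant contains-max) (splitAtMax-↔ n s)

-- Words as lists

bit : Bool → ℕ
bit b = if b then 1 else 0

ind-does : ∀ {p} {P : Set p} (d : Dec P) → ind d ≡ bit (does d)
ind-does (yes _) = refl
ind-does (no _)  = refl

sumFin-cong : ∀ n {f g : Fin n → ℕ} → (∀ i → f i ≡ g i) → sumFin n f ≡ sumFin n g
sumFin-cong zero    f≗g = refl
sumFin-cong (suc n) f≗g = cong₂ _+_ (f≗g fzero) (sumFin-cong n (f≗g ∘ fsuc))

sumFin-zero : ∀ n {f : Fin n → ℕ} → (∀ i → f i ≡ 0) → sumFin n f ≡ 0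
sumFin-zero zero    f≡0 = refl
sumFin-zero (suc n) f≡0 = cong₂ _+_ (f≡0 fzero) (sumFin-zero n (λ i → f≡0 (fsuc i)))

sumFin-count : ∀ n (p : ℕ → Bool) (g : Fin n → ℕ) → sumFin n (λ j → bit (p (g j))) ≡ count p (tabulate g)
sumFin-count zero    p g = refl
sumFin-count (suc n) p g with p (g fzero)
... | true  = cong suc (sumFin-count n p (λ j → g (fsuc j)))
... | false = sumFin-count n p (λ j → g (fsuc j))

sumFin-∧ : ∀ n (p : Fin n → Bool) c →
           sumFin n (λ k → bit (p k ∧ c)) ≡ (if c then sumFin n (λ k → bit (p k)) else 0)
sumFin-∧ n p true  = sumFin-cong n (λ k → cong bit (∧-identityʳ (p k)))
sumFin-∧ n p false = sumFin-zero n (λ k → cong bit (∧-zeroʳ (p k)))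

repeatedPairs-tabulate : ∀ n (f : Fin n → ℕ) →
  (sumFin n λ i → sumFin n λ j → ind ((toℕ i <? toℕ j) ×-dec (f i ≟ f j))) ≡ repeats (tabulate f)
repeatedPairs-tabulate n f = trans (sumFin-cong n (λ i → sumFin-cong n (λ j → ind-does _))) (go n f)
  where
  go : ∀ n (f : Fin n → ℕ) →
       (sumFin n λ i → sumFin n λ j → bit ((toℕ i <ᵇ toℕ j) ∧ (f i ≡ᵇ f j))) ≡ repeats (tabulate f)
  go zero    f = refl
  go (suc n) f = cong₂ _+_ (sumFin-count n (f fzero ≡ᵇ_) (f ∘ fsuc)) (go n (f ∘ fsuc))

count231-tabulate : ∀ n (f : Fin n → ℕ) →
  (sumFin n λ i → sumFin n λ j → sumFin n λ k →
     ind ((toℕ i <? toℕ j) ×-dec ((toℕ j <? toℕ k) ×-dec ((f k <? f i) ×-dec (f i <? f j)))))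
  ≡ count231 (tabulate f)
count231-tabulate n f =
  trans (sumFin-cong n (λ i → sumFin-cong n (λ j → sumFin-cong n (λ k → ind-does _)))) (go n f)
  where
  from : ∀ n → ℕ → (Fin n → ℕ) → ℕ
  from n x g = sumFin n λ j → sumFin n λ k → bit ((toℕ j <ᵇ toℕ k) ∧ ((g k <ᵇ x) ∧ (x <ᵇ g j)))
  from≡ : ∀ n x g → from n x g ≡ count231-from x (tabulate g)
  from≡ zero    x g = refl
  from≡ (suc n) x g = cong₂ _+_
    (trans (sumFin-∧ n (λ k → g (fsuc k) <ᵇ x) (x <ᵇ g fzero)) (first (x <ᵇ g fzero)))
    (from≡ n x (g ∘ fsuc))
    where
    first : ∀ c → (if c then sumFin n (λ k → bit (g (fsuc k) <ᵇ x)) else 0)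
                ≡ (if c then count (_<ᵇ x) (tabulate (g ∘ fsuc)) else 0)
    first true  = sumFin-count n (_<ᵇ x) (g ∘ fsuc)
    first false = refl
  go : ∀ n (f : Fin n → ℕ) →
       (sumFin n λ i → sumFin n λ j → sumFin n λ k →
          bit ((toℕ i <ᵇ toℕ j) ∧ ((toℕ j <ᵇ toℕ k) ∧ ((f k <ᵇ f i) ∧ (f i <ᵇ f j)))))
       ≡ count231 (tabulate f)
  go zero    f = refl
  go (suc n) f = cong₂ _+_
    (cong₂ _+_ (sumFin-zero (suc n) (λ _ → refl)) (from≡ n (f fzero) (f ∘ fsuc)))
    (trans (sumFin-cong n (λ i → cong₂ _+_ (sumFin-zero (suc n) (λ _ → refl))
                                           (sumFin-cong n (λ j → cong₂ _+_ (cong bit (∧-zeroʳ (toℕ i <ᵇ toℕ j)))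
                                                                            refl))))
           (go n (f ∘ fsuc)))

count13-2-tabulate : ∀ n (f : Fin n → ℕ) →
  (sumFin n λ i → sumFin n λ k → sumFin n λ j →
     ind ((toℕ k ≟ suc (toℕ i)) ×-dec ((toℕ k <? toℕ j) ×-dec ((f i <? f j) ×-dec (f j <? f k)))))
  ≡ count13-2 (tabulate f)
count13-2-tabulate n f =
  trans (sumFin-cong n (λ i → sumFin-cong n (λ k → sumFin-cong n (λ j → ind-does _)))) (go n f)
  where
  head : ∀ n → (Fin (suc n) → ℕ) → ℕ
  head n f = sumFin n λ k → sumFin (suc n) λ j →
    bit ((toℕ k ≡ᵇ 0) ∧ ((suc (toℕ k) <ᵇ toℕ j) ∧ ((f fzero <ᵇ f j) ∧ (f j <ᵇ f (fsuc k)))))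
  unfold : ∀ n f → count13-2 (tabulate f) ≡ head n f + count13-2 (tabulate (f ∘ fsuc))
  unfold zero    f = refl
  unfold (suc n) f = cong (_+ count13-2 (tabulate (f ∘ fsuc))) (sym (trans
    (cong₂ _+_ (sumFin-count n (between (f fzero) (f (fsuc fzero))) (f ∘ fsuc ∘ fsuc))
               (sumFin-zero n (λ _ → sumFin-zero (suc (suc n)) (λ _ → refl))))
    (+-identityʳ _)))
  go : ∀ n (f : Fin n → ℕ) →
       (sumFin n λ i → sumFin n λ k → sumFin n λ j →
          bit ((toℕ k ≡ᵇ suc (toℕ i)) ∧ ((toℕ k <ᵇ toℕ j) ∧ ((f i <ᵇ f j) ∧ (f j <ᵇ f k)))))
       ≡ count13-2 (tabulate f)
  go zero    f = refl
  go (suc n) f = trans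
    (cong₂ _+_ (cong₂ _+_ (sumFin-zero (suc n) (λ _ → refl)) refl)
               (trans (sumFin-cong n (λ i → cong₂ _+_ (sumFin-zero (suc n) (λ _ → refl))
                        (sumFin-cong n (λ k → cong₂ _+_ (cong bit (∧-zeroʳ (toℕ k ≡ᵇ suc (toℕ i)))) refl))))
                      (go n (f ∘ fsuc))))
    (sym (unfold n f))

toList : ∀ {k n} → Vec (Fin k) n → List ℕ
toList σ = tabulate (λ i → toℕ (lookup σ i))

fromList : ∀ {k} n (xs : List ℕ) → length xs ≡ n → All (_< k) xs → Vec (Fin k) n
fromList zero    []       _      _            = []
fromList (suc n) (x ∷ xs) |xs|≡n (x<k ∷ xs<k) = fromℕ< x<k ∷ fromList n xs (suc-injective |xs|≡n) xs<k

toList-fromList : ∀ {k} n xs (|xs|≡n : length xs ≡ n) (xs<k : All (_< k) xs) →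
                  toList (fromList n xs |xs|≡n xs<k) ≡ xs
toList-fromList zero    []       _      _            = refl
toList-fromList (suc n) (x ∷ xs) |xs|≡n (x<k ∷ xs<k) =
  cong₂ _∷_ (toℕ-fromℕ< x<k) (toList-fromList n xs (suc-injective |xs|≡n) xs<k)

fromList-toList : ∀ {k n} (σ : Vec (Fin k) n) |σ|≡n σ<k → fromList n (toList σ) |σ|≡n σ<k ≡ σ
fromList-toList []      _      _          = refl
fromList-toList (i ∷ σ) |σ|≡n (i<k ∷ σ<k) =
  cong₂ _∷_ (fromℕ<-toℕ i i<k) (fromList-toList σ (suc-injective |σ|≡n) σ<k)

Perm231With13-2↔Perm231 : ∀ n s → Perm231With13-2 n s ↔ Perm231 n s
Perm231With13-2↔Perm231 n s = mk↔ₛ′ to from to∘from from∘to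
  where
  to : Perm231With13-2 n s → Perm231 n s
  to (σ , repeated≡0 , avoids , occ≡s) = toList σ , isPerm231
    (length-tabulate _) (tabulate⁺ (λ i → toℕ<n (lookup σ i)))
    (trans (sym (repeatedPairs-tabulate n (val σ))) repeated≡0)
    (trans (sym (count231-tabulate n (val σ))) avoids)
    (trans (sym (count13-2-tabulate n (val σ))) occ≡s)
  from : Perm231 n s → Perm231With13-2 n s
  from (xs , isPerm231 |xs|≡n xs<n distinct avoids231 count13-2≡) =
    σ , trans (repeatedPairs-tabulate n (val σ)) (trans (cong repeats σ↦xs) distinct)
      , trans (count231-tabulate n (val σ)) (trans (cong count231 σ↦xs) avoids231)
      , trans (count13-2-tabulate n (val σ)) (trans (cong count13-2 σ↦xs) count13-2≡)
    where
    σ : Word n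
    σ = fromList n xs |xs|≡n xs<n
    σ↦xs : toList σ ≡ xs
    σ↦xs = toList-fromList n xs |xs|≡n xs<n
  to∘from : ∀ p → to (from p) ≡ p
  to∘from (xs , isPerm231 |xs|≡n xs<n _ _ _) = Perm231-≡ (toList-fromList n xs |xs|≡n xs<n) _ _
  from∘to : ∀ p → from (to p) ≡ p
  from∘to (σ , _) = same-word (fromList-toList σ _ _) _ _
    where
    same-word : ∀ {σ σ′} → σ ≡ σ′ → ∀ p q → _≡_ {A = Perm231With13-2 n s} (σ , p) (σ′ , q)
    same-word refl (r , a , o) (r′ , a′ , o′) =
      cong (_ ,_) (cong₂ _,_ (≡-irrelevant r r′) (cong₂ _,_ (≡-irrelevant a a′) (≡-irrelevant o o′)))

-- Counting coefficients

Antidiag : ℕ → (ℕ → ℕ → Set) → Set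
Antidiag n A = Σ[ i ∈ ℕ ] Σ[ i′ ∈ ℕ ] (i + i′ ≡ n) × A i i′

Antidiag-cong : ∀ n {A B : ℕ → ℕ → Set} → (∀ i i′ → i + i′ ≡ n → A i i′ ↔ B i i′) →
                Antidiag n A ↔ Antidiag n B
Antidiag-cong n A↔B = congˡ (congˡ (congˡ (λ {i+i′≡n} → A↔B _ _ i+i′≡n)))

Antidiag-zero : ∀ (A : ℕ → ℕ → Set) → A 0 0 ↔ Antidiag 0 A
Antidiag-zero A = mk↔ₛ′ (λ x → 0 , 0 , refl , x) from (λ { (0 , 0 , refl , x) → refl }) (λ _ → refl)
  where
  from : Antidiag 0 A → A 0 0
  from (0 , 0 , refl , x) = x

Antidiag-suc : ∀ n (A : ℕ → ℕ → Set) → (A 0 (suc n) ⊎ Antidiag n (λ i → A (suc i))) ↔ Antidiag (suc n) A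
Antidiag-suc n A = mk↔ₛ′ to from to∘from from∘to
  where
  to : A 0 (suc n) ⊎ Antidiag n (λ i → A (suc i)) → Antidiag (suc n) A
  to (inj₁ x)                     = 0 , suc n , refl , x
  to (inj₂ (i , i′ , i+i′≡n , x)) = suc i , i′ , cong suc i+i′≡n , x
  from : Antidiag (suc n) A → A 0 (suc n) ⊎ Antidiag n (λ i → A (suc i))
  from (zero  , .(suc n) , refl     , x) = inj₁ x
  from (suc i , i′       , i+i′≡1+n , x) = inj₂ (i , i′ , suc-injective i+i′≡1+n , x)
  to∘from : ∀ y → to (from y) ≡ y
  to∘from (zero  , .(suc n) , refl , x) = refl
  to∘from (suc i , i′ , i+i′≡1+n , x) = cong (λ e → suc i , i′ , e , x) (≡-irrelevant _ _)
  from∘to : ∀ x → from (to x) ≡ x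
  from∘to (inj₁ x) = refl
  from∘to (inj₂ (i , i′ , i+i′≡n , x)) = cong (λ e → inj₂ (i , i′ , e , x)) (≡-irrelevant _ _)

Fin-antidiag : ∀ n g → Fin (antidiag n g) ↔ Antidiag n (λ i i′ → Fin (g i i′))
Fin-antidiag zero    g = Antidiag-zero _
Fin-antidiag (suc n) g =
  ↔-trans +↔⊎ (↔-trans (↔-refl ⊎-cong Fin-antidiag n (λ i → g (suc i))) (Antidiag-suc n _))

≡-↔ : ∀ {a b c e : ℕ} → (a ≡ b → c ≡ e) → (c ≡ e → a ≡ b) → (a ≡ b) ↔ (c ≡ e)
≡-↔ f g = mk↔ₛ′ f g (λ _ → ≡-irrelevant _ _) (λ _ → ≡-irrelevant _ _)

∸-≡ : ∀ {j d} x → j ≤ d → (j + x ≡ d) ↔ (x ≡ d ∸ j)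
∸-≡ {j} x j≤d = ≡-↔ (λ { refl → sym (m+n∸m≡n j x) }) (λ { refl → m+[n∸m]≡n j≤d })

⊥↔ : ∀ {A : Set} → ¬ A → ⊥ ↔ A
⊥↔ ¬a = mk↔ₛ′ (λ ()) ¬a (λ a → ⊥-elim (¬a a)) (λ ())

Weighted : ℕ → ℕ → ℕ → Set
Weighted j n d = Σ[ s ∈ ℕ ] (j * n + s ≡ d) × Perm231 n s

Weighted⁺ : ℕ → ℕ → ℕ → Set
Weighted⁺ j zero    d = ⊥
Weighted⁺ j (suc a) d = Weighted j (suc a) d

Fin-one↔Weighted : ∀ j d → Fin (one 0 d) ↔ Weighted j 0 d
Fin-one↔Weighted j zero = ↔-trans 1↔⊤ (mk↔ₛ′ (λ _ → empty) (λ _ → tt) unique (λ _ → refl))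
  where
  empty : Weighted j 0 0
  empty = 0 , trans (+-identityʳ (j * 0)) (*-zeroʳ j) , [] , isPerm231 refl [] refl refl refl
  unique : ∀ w → empty ≡ w
  unique (.0 , e , [] , isPerm231 refl [] refl refl refl) = cong (λ e → 0 , e , [] , _) (≡-irrelevant _ _)
Fin-one↔Weighted j (suc d) = ↔-trans 0↔⊥ (⊥↔ none)
  where
  none : ¬ Weighted j 0 (suc d)
  none (.0 , e , [] , isPerm231 refl [] refl refl refl) with trans (sym e) (trans (+-identityʳ (j * 0)) (*-zeroʳ j))
  ... | ()

Fin-cong : ∀ {x y} → x ≡ y → Fin x ↔ Fin y
Fin-cong refl = ↔-refl

Fin-⊛ : ∀ A B n e →
        Fin ((A ⊛ B) n e) ↔ Antidiag n (λ b a → Antidiag e (λ e₁ e₂ → Fin (A b e₁) × Fin (B a e₂)))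
Fin-⊛ A B n e = begin
  Fin ((A ⊛ B) n e)
    ↔⟨ Fin-cong (⊛-antidiag A B n e) ⟩
  Fin (antidiag n (λ b a → antidiag e (λ e₁ e₂ → A b e₁ * B a e₂)))
    ↔⟨ Fin-antidiag n _ ⟩
  Antidiag n (λ b a → Fin (antidiag e (λ e₁ e₂ → A b e₁ * B a e₂)))
    ↔⟨ Antidiag-cong n (λ b a _ → Fin-antidiag e _) ⟩
  Antidiag n (λ b a → Antidiag e (λ e₁ e₂ → Fin (A b e₁ * B a e₂)))
    ↔⟨ Antidiag-cong n (λ b a _ → Antidiag-cong e (λ _ _ _ → *↔×)) ⟩
  Antidiag n (λ b a → Antidiag e (λ e₁ e₂ → Fin (A b e₁) × Fin (B a e₂))) ∎
  where open Function.Related.Propositional.EquationalReasoning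

GluedWeighted : ℕ → ℕ → ℕ → Set
GluedWeighted j n e = Antidiag n (λ b a → Antidiag e (λ e₁ e₂ → Weighted (suc j) b e₁ × Weighted⁺ j a e₂))

-- Beyond the factor q^j, the weight q^(jn + s) of α n β splits as q^((j+1)|β| + s₂) · q^(j|α| + s₁).
glued-weight : ∀ j a b s₁ s₂ → j * (suc a + b) + (s₁ + (s₂ + b)) ≡ (suc j * b + s₂) + (j * suc a + s₁)
glued-weight = solve-∀

Glued↔GluedWeighted : ∀ j n e → (Σ[ s ∈ ℕ ] (j * n + s ≡ e) × Glued n s) ↔ GluedWeighted j n e
Glued↔GluedWeighted j n e = mk↔ₛ′ to from to∘from from∘to
  where
  to : (Σ[ s ∈ ℕ ] (j * n + s ≡ e) × Glued n s) → GluedWeighted j n e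
  to (s , e≡ , (a , b , s₁ , s₂ , A+b≡n , s≡ , p , q)) =
    b , suc a , trans (+-comm b (suc a)) A+b≡n , suc j * b + s₂ , j * suc a + s₁ , weight ,
    (s₂ , refl , q) , (s₁ , refl , p)
    where
    weight : (suc j * b + s₂) + (j * suc a + s₁) ≡ e
    weight = trans (sym (glued-weight j a b s₁ s₂)) (trans (cong₂ (λ n s → j * n + s) A+b≡n (sym s≡)) e≡)
  from : GluedWeighted j n e → (Σ[ s ∈ ℕ ] (j * n + s ≡ e) × Glued n s)
  from (b , suc a , b+A≡n , .(suc j * b + s₂) , .(j * suc a + s₁) , weight ,
        (s₂ , refl , q) , (s₁ , refl , p)) =
    s₁ + (s₂ + b) ,
    trans (cong₂ (λ n s → j * n + s) (sym A+b≡n) refl) (trans (glued-weight j a b s₁ s₂) weight) ,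
    (a , b , s₁ , s₂ , A+b≡n , refl , p , q)
    where
    A+b≡n : suc a + b ≡ n
    A+b≡n = trans (+-comm (suc a) b) b+A≡n
  to∘from : ∀ w → to (from w) ≡ w
  to∘from (b , suc a , _ , .(suc j * b + s₂) , .(j * suc a + s₁) , _ ,
           (s₂ , refl , q) , (s₁ , refl , p)) =
    cong₂ (λ u v → b , suc a , u , suc j * b + s₂ , j * suc a + s₁ , v , (s₂ , refl , q) , (s₁ , refl , p))
          (≡-irrelevant _ _) (≡-irrelevant _ _)
  from∘to : ∀ g → from (to g) ≡ g
  from∘to (.(s₁ + (s₂ + b)) , _ , (a , b , s₁ , s₂ , _ , refl , p , q)) =
    cong₂ (λ u v → s₁ + (s₂ + b) , u , (a , b , s₁ , s₂ , v , refl , p , q))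
          (≡-irrelevant _ _) (≡-irrelevant _ _)

Weighted-suc : ∀ j n d → j ≤ d → Weighted j (suc n) d ↔ (Weighted j n (d ∸ j) ⊎ GluedWeighted j n (d ∸ j))
Weighted-suc j n d j≤d = begin
  (Σ[ s ∈ ℕ ] (j * suc n + s ≡ d) × Perm231 (suc n) s)
    ↔⟨ congˡ (eq ×-cong Perm231-suc-↔ n _) ⟩
  (Σ[ s ∈ ℕ ] (j * n + s ≡ d ∸ j) × (Perm231 n s ⊎ Glued n s))
    ↔⟨ congˡ ×-distribˡ-⊎ ⟩
  (Σ[ s ∈ ℕ ] ((j * n + s ≡ d ∸ j) × Perm231 n s ⊎ (j * n + s ≡ d ∸ j) × Glued n s))
    ↔⟨ Σ-distribˡ-⊎ ⟩
  (Weighted j n (d ∸ j) ⊎ (Σ[ s ∈ ℕ ] (j * n + s ≡ d ∸ j) × Glued n s))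
    ↔⟨ ↔-refl ⊎-cong Glued↔GluedWeighted j n (d ∸ j) ⟩
  (Weighted j n (d ∸ j) ⊎ GluedWeighted j n (d ∸ j)) ∎
  where
  open Function.Related.Propositional.EquationalReasoning
  regroup : ∀ s → j * suc n + s ≡ j + (j * n + s)
  regroup s = trans (cong (_+ s) (*-suc j n)) (+-assoc j (j * n) s)
  eq : ∀ {s} → (j * suc n + s ≡ d) ↔ (j * n + s ≡ d ∸ j)
  eq {s} = ↔-trans (≡-↔ (trans (sym (regroup s))) (trans (regroup s))) (∸-≡ (j * n + s) j≤d)

Weighted-> : ∀ j n d → d < j → ¬ Weighted j (suc n) d
Weighted-> j n d d<j (s , refl , _) =
  <⇒≱ d<j (≤-trans (≤-trans (m≤m+n j (j * n)) (≤-reflexive (sym (*-suc j n)))) (m≤m+n (j * suc n) s))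

CountsWeighted : ℕ → Set
CountsWeighted n = ∀ j m → n * 2 ≤ m → ∀ d → Fin (conv m (j * 2) n d) ↔ Weighted j n d

conv-constant : ∀ m k d → conv m k 0 d ≡ one 0 d
conv-constant zero    k d = refl
conv-constant (suc m) k d = refl

counts-zero : CountsWeighted 0
counts-zero j m _ d = ↔-trans (Fin-cong (conv-constant m (j * 2) d)) (Fin-one↔Weighted j d)

counts-suc : ∀ n → (∀ {k} → k < suc n → CountsWeighted k) → CountsWeighted (suc n)
counts-suc n IH j (suc (suc m)) (s≤s (s≤s 2n≤m)) d with j ≤? d
... | no j≰d = begin
  Fin (conv (suc (suc m)) (j * 2) (suc n) d)
    ↔⟨ Fin-cong (trans (conv-twoLevels m j (suc n) d) (H-suc-> n d (≰⇒> j≰d))) ⟩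
  Fin 0
    ↔⟨ 0↔⊥ ⟩
  ⊥
    ↔⟨ ⊥↔ (Weighted-> j n d (≰⇒> j≰d)) ⟩
  Weighted j (suc n) d ∎
  where
  open TwoLevels j (conv m (suc j * 2))
  open Function.Related.Propositional.EquationalReasoning
... | yes j≤d = begin
  Fin (conv (suc (suc m)) (j * 2) (suc n) d)
    ↔⟨ Fin-cong (trans (conv-twoLevels m j (suc n) d) (H-suc-≤ n d j≤d)) ⟩
  Fin (H n (d ∸ j) + (E ⊛ H⁺) n (d ∸ j))
    ↔⟨ +↔⊎ ⟩
  (Fin (H n (d ∸ j)) ⊎ Fin ((E ⊛ H⁺) n (d ∸ j)))
    ↔⟨ count-H n ≤-refl (d ∸ j) ⊎-cong count-glued (d ∸ j) ⟩
  (Weighted j n (d ∸ j) ⊎ GluedWeighted j n (d ∸ j))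
    ↔⟨ Weighted-suc j n d j≤d ⟨
  Weighted j (suc n) d ∎
  where
  E : Series
  E = conv m (suc j * 2)
  open TwoLevels j E
  open Function.Related.Propositional.EquationalReasoning
  2k≤m : ∀ {k} → k ≤ n → k * 2 ≤ m
  2k≤m k≤n = ≤-trans (*-monoˡ-≤ 2 k≤n) 2n≤m
  count-H : ∀ k → k ≤ n → ∀ e → Fin (H k e) ↔ Weighted j k e
  count-H k k≤n e = ↔-trans (Fin-cong (sym (conv-twoLevels m j k e)))
                            (IH (s≤s k≤n) j (suc (suc m)) (m≤n⇒m≤1+n (m≤n⇒m≤1+n (2k≤m k≤n))) e)
  count-H⁺ : ∀ a → a ≤ n → ∀ e → Fin (H⁺ a e) ↔ Weighted⁺ j a e
  count-H⁺ zero    _     e = ↔-trans (Fin-cong (H⁺-zero e)) 0↔⊥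
  count-H⁺ (suc a) a<n e = ↔-trans (Fin-cong (H⁺-suc a e)) (count-H (suc a) a<n e)
  count-E : ∀ b → b ≤ n → ∀ e → Fin (E b e) ↔ Weighted (suc j) b e
  count-E b b≤n e = IH (s≤s b≤n) (suc j) m (2k≤m b≤n) e
  count-glued : ∀ e → Fin ((E ⊛ H⁺) n e) ↔ GluedWeighted j n e
  count-glued e = ↔-trans (Fin-⊛ E H⁺ n e) (Antidiag-cong n (λ b a b+a≡n → Antidiag-cong e (λ e₁ e₂ _ →
    count-E b (subst (b ≤_) b+a≡n (m≤m+n b a)) e₁ ×-cong
    count-H⁺ a (subst (a ≤_) b+a≡n (m≤n+m a b)) e₂)))

counts : ∀ n → CountsWeighted n
counts = <-rec CountsWeighted step
  where
  step : ∀ n → (∀ {k} → k < n → CountsWeighted k) → CountsWeighted n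
  step zero    _  = counts-zero
  step (suc n) IH = counts-suc n IH

theorem3p11 : ∀ (n : ℕ) → ∃[ M ] (∀ (m : ℕ) → M ≤ m → ∀ (d : ℕ) →
                Perm231With13-2 n d ↔ Fin (conv m 0 n d))
theorem3p11 n = n * 2 , λ m 2n≤m d → begin
  Perm231With13-2 n d    ↔⟨ Perm231With13-2↔Perm231 n d ⟩
  Perm231 n d            ↔⟨ ∃-≡ (Perm231 n) ⟩
  Weighted 0 n d         ↔⟨ counts n 0 m 2n≤m d ⟨
  Fin (conv m 0 n d)     ∎
  where open Function.Related.Propositional.EquationalReasoning
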